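{- For every signed graph $(G,\tau)$, the toric ideal $I_{(G,\tau)}$ is generated by $\{B_{\mathbf{w}} : \mathbf{w}\text{ is an even closed walk in }(G,\tau)\}$.
   Context: Graphs are finite and simple. A sign of $G$ is a function $\tau$ from the pairs $(e,v)$ ($v$ an endpoint of edge $e$) to $\{1,-1\}$. The incidence matrix $A=A(G,\tau)$ has rows indexed by vertices, columns by edges $e_1,\dots,e_m$, entry $\tau(e,v)$ if $v\in e$ and $0$ otherwise. For a field $K$, $I_{(G,\tau)}\subseteq K[e_1,\dots,e_m]$ is generated by all $\mathbb{e}^{\mathbb{b}^+}-\mathbb{e}^{\mathbb{b}^- }$ with $\mathbb{b}\in\mathbb{Z}^m$, $A\mathbb{b}=0$, where $\mathbb{e}^{\mathbb{x}}=\prod e_i^{x_i}$, $\mathbb{b}^+_i=\max\{b_i,0\}$, $\mathbb{b}^-_i=-\min\{b_i,0\}$. For a closed walk $\mathbf{w}:v_1e_1v_2\cdots e_tv_1$ ($e_i=v_iv_{i+1}$, $t\ge 2$), a vertex term $v_i$ is unbalanced if $\tau(e_{i-1},v_i)\tau(e_i,v_i)=1$ (indices cyclic, so $e_0=e_t$); $\mathbf{w}$ is even if the number of unbalanced vertex terms is even. A balanced section is a maximal section (consecutive terms, cyclically) with no internal unbalanced vertex term. If $\mathbf{w}$ is even and has an unbalanced vertex term, starting it at one, it decomposes uniquely into consecutive balanced sections $\mathbf{w}_0,\dots,\mathbf{w}_{2k-1}$, and $B_{\mathbf{w}}=\prod_{i\text{ even}}\prod_{e\in E(\mathbf{w}_i)}e-\prod_{i\text{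 odd}}\prod_{e\in E(\mathbf{w}_i)}e$ (edges with multiplicity); if $\mathbf{w}$ has no unbalanced vertex term, $B_{\mathbf{w}}=\prod_{e\in E(\mathbf{w})}e-1$. $B_{\mathbf{w}}$ is determined up to sign. -}

module Defs where

open import Level using (Level; _⊔_) renaming (suc to lsuc)
open import Algebra.Bundles using (CommutativeRing)
open import Data.Nat as ℕ using (ℕ; zero; suc; NonZero)
open import Data.Nat.DivMod using (_mod_)
open import Data.Integer as ℤ using (ℤ; ∣_∣)
open import Data.Sign as Sign using (Sign)
open import Data.Fin as Fin using (Fin; toℕ)
open import Data.Fin.Properties as FinP using ()
open import Data.Vec as Vec using (Vec; tabulate)
open import Data.Vec.Properties as VecP using ()
open import Data.List as List using (List; []; _∷_; _++_; foldr; map; concatMap; allFin)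
open import Data.List.Relation.Unary.All using (All)
open import Data.Product using (Σ; ∃; _×_; _,_; proj₁; proj₂)
open import Data.Sum using (_⊎_)
open import Data.Bool using (Bool; true; false; if_then_else_; _∨_)
open import Relation.Nullary using (¬_; does)
open import Relation.Binary.PropositionalEquality using (_≡_; _≢_)

record Field c ℓ : Set (lsuc (c ⊔ ℓ)) where
  field
    commutativeRing : CommutativeRing c ℓ
  open CommutativeRing commutativeRing public
  field
    1≉0     : ¬ (1# ≈ 0#)
    inverse : ∀ x → ¬ (x ≈ 0#) → ∃ λ y → x * y ≈ 1#

-- Polynomials in K[e_1,…,e_m]: finite formal sums of terms c·e^α,
-- α ∈ ℕ^m, compared coefficientwise.

Monomial : ℕ → Set
Monomial m = Vec ℕ m

module Poly {c ℓ} (K : Field c ℓ) (m : ℕ) where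
  open Field K

  Polynomial : Set c
  Polynomial = List (Carrier × Monomial m)

  coeff : Polynomial → Monomial m → Carrier
  coeff f α = foldr (λ t acc → if does (VecP.≡-dec ℕ._≟_ α (proj₂ t))
                                 then proj₁ t + acc else acc) 0# f

  _≋_ : Polynomial → Polynomial → Set ℓ
  f ≋ g = ∀ α → coeff f α ≈ coeff g α

  _⊕_ : Polynomial → Polynomial → Polynomial
  f ⊕ g = f ++ g

  _⊗_ : Polynomial → Polynomial → Polynomial
  f ⊗ g = concatMap (λ s → map (λ t → (proj₁ s * proj₁ t ,
                                Vec.zipWith ℕ._+_ (proj₂ s) (proj₂ t))) g) f

  zeroP : Polynomial
  zeroP = []

  binomial : Monomial m → Monomial m → Polynomial
  binomial α β = (1# , α) ∷ (- 1# , β) ∷ []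

  InIdeal : ∀ {p} → (Polynomial → Set p) → Polynomial → Set (c ⊔ ℓ ⊔ p)
  InIdeal S f = Σ (List (Polynomial × Polynomial)) λ qs →
                  All (λ qg → S (proj₂ qg)) qs ×
                  (f ≋ foldr (λ qg acc → (proj₁ qg ⊗ proj₂ qg) ⊕ acc) zeroP qs)

  SameIdeal : ∀ {p q} → (Polynomial → Set p) → (Polynomial → Set q) → Set (c ⊔ ℓ ⊔ p ⊔ q)
  SameIdeal S T = (∀ f → InIdeal S f → InIdeal T f) × (∀ f → InIdeal T f → InIdeal S f)

isEvenℕ : ℕ → Bool
isEvenℕ zero = true
isEvenℕ (suc zero) = false
isEvenℕ (suc (suc n)) = isEvenℕ n

SameEnds : ∀ {n} → Fin n × Fin n → Fin n × Fin n → Set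
SameEnds (a , b) (c , d) = (a ≡ c × b ≡ d) ⊎ (a ≡ d × b ≡ c)

record SignedGraph (n m : ℕ) : Set where
  field
    ends     : Fin m → Fin n × Fin n
    loopless : ∀ e → proj₁ (ends e) ≢ proj₂ (ends e)
    simple   : ∀ e f → SameEnds (ends e) (ends f) → e ≡ f
    -- τ(e,v); only its values at endpoints v of e are ever used
    τ        : Fin m → Fin n → Sign

module _ {n m : ℕ} (G : SignedGraph n m) where
  open SignedGraph G

  incident : Fin n → Fin m → Bool
  incident v e = does (v Fin.≟ proj₁ (ends e)) ∨ does (v Fin.≟ proj₂ (ends e))

  signℤ : Sign → ℤ
  signℤ Sign.+ = ℤ.1ℤ
  signℤ Sign.- = ℤ.-1ℤ

  incidence : Fin n → Fin m → ℤ
  incidence v e = if incident v e then signℤ (τ e v) else ℤ.0ℤ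

  InKernel : (Fin m → ℤ) → Set
  InKernel b = ∀ v → foldr ℤ._+_ ℤ.0ℤ (map (λ e → incidence v e ℤ.* b e) (allFin m)) ≡ ℤ.0ℤ

  posPart negPart : (Fin m → ℤ) → Monomial m
  posPart b = tabulate (λ i → ∣ b i ℤ.⊔ ℤ.0ℤ ∣)
  negPart b = tabulate (λ i → ∣ b i ℤ.⊓ ℤ.0ℤ ∣)

  next prev : ∀ {k} → Fin (suc k) → Fin (suc k)
  next {k} i = suc (toℕ i) mod suc k
  prev {k} i = (toℕ i ℕ.+ k) mod suc k

  -- closed walk v_0 e_0 v_1 ⋯ e_{t-1} v_0 of length t = suc k ≥ 2
  record ClosedWalk : Set where
    field
      k     : ℕ
      len≥2 : 1 ℕ.≤ k
      vtx   : Fin (suc k) → Fin n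
      edg   : Fin (suc k) → Fin m
      joins : ∀ i → SameEnds (ends (edg i)) (vtx i , vtx (next i))

    countF : (Fin (suc k) → Bool) → ℕ
    countF p = foldr ℕ._+_ 0 (map (λ i → if p i then 1 else 0) (allFin (suc k)))

    unbalanced : Fin (suc k) → Bool
    unbalanced i = does (Sign._*_ (τ (edg (prev i)) (vtx i)) (τ (edg i) (vtx i)) Sign.≟ Sign.+)

    IsEven : Set
    IsEven = ∃ λ j → countF unbalanced ≡ 2 ℕ.* j

    -- index of the balanced section containing e_i, mod 2, numbering from
    -- v_0: parity of #{ 1 ≤ j ≤ i : v_j unbalanced }.  (For an even walk
    -- this is the paper's decomposition w_0,…,w_{2k-1} started at the
    -- first unbalanced vertex term, up to swapping the two monomials; with
    -- no unbalanced vertex term all edges are in the "even" part.)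
    evenSection : Fin (suc k) → Bool
    evenSection i = isEvenℕ (countF (λ j → does (1 ℕ.≤? toℕ j) Data.Bool.∧
                                                  does (toℕ j ℕ.≤? toℕ i) Data.Bool.∧
                                                  unbalanced j))
      where import Data.Bool

    edgeMonomial : Bool → Monomial m
    edgeMonomial b = tabulate λ e →
      countF (λ i → does (edg i Fin.≟ e) Data.Bool.∧ does (evenSection i Data.Bool.≟ b))
      where import Data.Bool

  module _ {c ℓ} (K : Field c ℓ) where
    open Poly K m

    Bw : ClosedWalk → Polynomial
    Bw w = binomial (ClosedWalk.edgeMonomial w true) (ClosedWalk.edgeMonomial w false)

    ToricGen : Polynomial → Set c
    ToricGen f = ∃ λ b → InKernel b × f ≡ binomial (posPart b) (negPart b)

    EvenWalkGen : Polynomial → Set c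
    EvenWalkGen f = ∃ λ (w : ClosedWalk) → ClosedWalk.IsEven w × f ≡ Bw w

-- Both ideals are generated by binomials, so it suffices to put the generators of each into the
-- other. Colour the edges of an even closed walk w by the parity of their balanced section: the
-- colour changes exactly at the unbalanced vertex terms, and this makes the signed edge vector
-- α − β of B_w = e^α − e^β a kernel element of the incidence matrix A. So B_w is e^min(α,β)
-- times the toric generator of α − β.
-- Conversely let Au = Av with u ≠ 0. Walk greedily, starting along an edge in the support of u:
-- from the current vertex leave along an edge of u or of v whose use cancels the defect the walk
-- has left at that vertex. The defect can only vanish back at the start; the closed walk w
-- obtained is even, and B_w = e^α − e^β where α ≤ u counts the edges taken from u and β ≤ v
-- those taken from v. Then e^u − e^v = e^(u−α) B_w + e^β (e^(u−α) − e^(v−β)), and induction on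
-- the degree concludes.

module Submission where

open import Defs
open import Data.Nat using (ℕ)

import Algebra.Properties.Ring as RingProperties
import Algebra.Properties.Semiring.Sum as SemiringSum
import Data.Bool as Bool
open import Data.Bool using (Bool; true; false; if_then_else_; _∧_; _∨_; _xor_; not)
open import Data.Bool.Properties using (∨-comm; xor-same; xor-assoc; xor-identityʳ; xor-inverseˡ)
open import Data.Empty using (⊥-elim)
open import Data.Fin as Fin using (Fin; zero; suc; toℕ; inject₁; fromℕ)
open import Data.Fin.Induction using (<-weakInduction)
open import Data.Fin.Properties as FinP using (toℕ-injective; toℕ-inject₁; toℕ-fromℕ; toℕ-fromℕ<)
import Data.Fin.Relation.Unary.Top as Top
open import Data.List as List using (List; []; _∷_; _++_; foldr; map; length)
open import Data.List.Relation.Unary.All using (All; []; _∷_)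
open import Data.List.Relation.Unary.All.Properties using (++⁺)
import Data.List.Properties as ListP
import Data.Nat.ListAction as ListAction
open import Data.Nat as ℕ using (zero; suc; z≤n; s≤s)
open import Data.Nat.DivMod using (_%_; m<n⇒m%n≡m; n%n≡0; [m+n]%n≡m%n)
import Data.Nat.Properties as ℕP
open import Algebra.Properties.CommutativeSemigroup ℕP.+-commutativeSemigroup
  using () renaming (interchange to +-interchange)
open import Data.Product using (∃; _×_; _,_; proj₁; proj₂)
open import Data.Sign as Sign using (Sign)
import Data.Sign.Properties as SignP
open import Data.Sum using (_⊎_; inj₁; inj₂)
open import Data.Vec as Vec using (Vec; []; _∷_; lookup)
import Data.Vec.Functional as Vector
import Data.Vec.Properties as VecP
open import Function using (_∘_; id)
open import Level using (_⊔_)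
open import Relation.Binary.Bundles using (Setoid)
open import Relation.Binary.PropositionalEquality as ≡ using (_≡_; _≢_)
import Relation.Binary.Reasoning.Setoid as SetoidReasoning
open import Relation.Nullary using (Dec; yes; no; does; ¬_)
open import Relation.Nullary.Decidable using (dec-true; dec-false; _×-dec_)

infixl 6 _+ᵐ_

_+ᵐ_ : ∀ {m} → Monomial m → Monomial m → Monomial m
_+ᵐ_ = Vec.zipWith ℕ._+_

+ᵐ-assoc : ∀ {m} (a b c : Monomial m) → (a +ᵐ b) +ᵐ c ≡ a +ᵐ (b +ᵐ c)
+ᵐ-assoc []      []      []      = ≡.refl
+ᵐ-assoc (x ∷ a) (y ∷ b) (z ∷ c) = ≡.cong₂ _∷_ (ℕP.+-assoc x y z) (+ᵐ-assoc a b c)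

+ᵐ-comm : ∀ {m} (a b : Monomial m) → a +ᵐ b ≡ b +ᵐ a
+ᵐ-comm []      []      = ≡.refl
+ᵐ-comm (x ∷ a) (y ∷ b) = ≡.cong₂ _∷_ (ℕP.+-comm x y) (+ᵐ-comm a b)

+ᵐ-identityʳ : ∀ {m} (a : Monomial m) → a +ᵐ Vec.replicate m 0 ≡ a
+ᵐ-identityʳ []      = ≡.refl
+ᵐ-identityʳ (x ∷ a) = ≡.cong₂ _∷_ (ℕP.+-identityʳ x) (+ᵐ-identityʳ a)

_≤ᵐ_ : ∀ {m} → Monomial m → Monomial m → Set
α ≤ᵐ u = ∀ e → lookup α e ℕ.≤ lookup u e

degree : ∀ {m} → Monomial m → ℕ
degree = Vec.sum

degree-decrement : ∀ {m} (u : Monomial m) e → 1 ℕ.≤ lookup u e → suc (degree (Vec.updateAt u e ℕ.pred)) ≡ degree u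
degree-decrement (suc a ∷ u) zero    _    = ≡.refl
degree-decrement (a ∷ u)     (suc e) 1≤uₑ = ≡.trans (≡.sym (ℕP.+-suc a _)) (≡.cong (a ℕ.+_) (degree-decrement u e 1≤uₑ))

size : ∀ {m} → Monomial m → Monomial m → ℕ
size u v = degree u ℕ.+ degree v

_∸ᵐ_ : ∀ {m} → Monomial m → Monomial m → Monomial m
_∸ᵐ_ = Vec.zipWith ℕ._∸_

∸ᵐ-+ᵐ : ∀ {m} (u α : Monomial m) → α ≤ᵐ u → (u ∸ᵐ α) +ᵐ α ≡ u
∸ᵐ-+ᵐ []      []      _   = ≡.refl
∸ᵐ-+ᵐ (x ∷ u) (a ∷ α) α≤u = ≡.cong₂ _∷_ (ℕP.m∸n+n≡m (α≤u zero)) (∸ᵐ-+ᵐ u α (α≤u ∘ suc))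

degree-+ᵐ : ∀ {m} (a b : Monomial m) → degree (a +ᵐ b) ≡ degree a ℕ.+ degree b
degree-+ᵐ []      []      = ≡.refl
degree-+ᵐ (x ∷ a) (y ∷ b) = ≡.trans (≡.cong (x ℕ.+ y ℕ.+_) (degree-+ᵐ a b)) (+-interchange x y (degree a) (degree b))

degree-∸ᵐ : ∀ {m} (u α : Monomial m) → α ≤ᵐ u → degree (u ∸ᵐ α) ℕ.+ degree α ≡ degree u
degree-∸ᵐ u α α≤u = ≡.trans (≡.sym (degree-+ᵐ (u ∸ᵐ α) α)) (≡.cong degree (∸ᵐ-+ᵐ u α α≤u))

size-∸ᵐ : ∀ {m} (u v α β : Monomial m) → α ≤ᵐ u → β ≤ᵐ v →
          size (u ∸ᵐ α) (v ∸ᵐ β) ℕ.+ size α β ≡ size u v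
size-∸ᵐ u v α β α≤u β≤v =
  ≡.trans (+-interchange (degree (u ∸ᵐ α)) (degree (v ∸ᵐ β)) (degree α) (degree β))
          (≡.cong₂ ℕ._+_ (degree-∸ᵐ u α α≤u) (degree-∸ᵐ v β β≤v))

lookup≤degree : ∀ {m} (u : Monomial m) e → lookup u e ℕ.≤ degree u
lookup≤degree (x ∷ u) zero    = ℕP.m≤m+n x _
lookup≤degree (x ∷ u) (suc e) = ℕP.≤-trans (lookup≤degree u e) (ℕP.m≤n+m _ x)

lookup-ext : ∀ {a} {A : Set a} {m} {xs ys : Vec A m} → (∀ e → lookup xs e ≡ lookup ys e) → xs ≡ ys
lookup-ext {xs = xs} {ys} xsₑ≡ysₑ =
  ≡.trans (≡.sym (VecP.tabulate∘lookup xs)) (≡.trans (VecP.tabulate-cong xsₑ≡ysₑ) (VecP.tabulate∘lookup ys))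

NonzeroEntry : ∀ {m} → Monomial m → Set
NonzeroEntry u = ∃ λ e → 1 ℕ.≤ lookup u e

nonzero-entry : ∀ {m} (u : Monomial m) → NonzeroEntry u ⊎ (∀ e → lookup u e ≡ 0)
nonzero-entry []          = inj₂ λ ()
nonzero-entry (suc a ∷ u) = inj₁ (zero , s≤s z≤n)
nonzero-entry (zero ∷ u) with nonzero-entry u
... | inj₁ (e , 1≤uₑ) = inj₁ (suc e , 1≤uₑ)
... | inj₂ u≡0       = inj₂ λ { zero → ≡.refl ; (suc e) → u≡0 e }

module Polynomials {c ℓ} (K : Field c ℓ) (m : ℕ) where
  open Field K
  open Poly K m
  open RingProperties ring using (-‿involutive; -1*x≈-x)
  open import Algebra.Properties.CommutativeSemigroup +-commutativeSemigroup using (interchange; x∙yz≈y∙xz)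
  module ≈-Reasoning = SetoidReasoning setoid

  Term : Set c
  Term = Carrier × Monomial m

  coeffTerm : Monomial m → Term → Carrier
  coeffTerm α (x , a) = if does (VecP.≡-dec ℕ._≟_ α a) then x else 0#

  coeffTerm-cong : ∀ α {x y} a → x ≈ y → coeffTerm α (x , a) ≈ coeffTerm α (y , a)
  coeffTerm-cong α a x≈y with does (VecP.≡-dec ℕ._≟_ α a)
  ... | true  = x≈y
  ... | false = refl

  coeffTerm-cancel : ∀ α {x y} a → x + y ≈ 0# → coeffTerm α (x , a) + coeffTerm α (y , a) ≈ 0#
  coeffTerm-cancel α a x+y≈0 with does (VecP.≡-dec ℕ._≟_ α a)
  ... | true  = x+y≈0
  ... | false = +-identityʳ 0#

  coeff-∷ : ∀ t f α → coeff (t ∷ f) α ≈ coeffTerm α t + coeff f α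
  coeff-∷ (x , a) f α with does (VecP.≡-dec ℕ._≟_ α a)
  ... | true  = refl
  ... | false = sym (+-identityˡ _)

  coeff-++ : ∀ f g α → coeff (f ++ g) α ≈ coeff f α + coeff g α
  coeff-++ []      g α = sym (+-identityˡ _)
  coeff-++ (t ∷ f) g α = begin
    coeff (t ∷ (f ++ g)) α               ≈⟨ coeff-∷ t (f ++ g) α ⟩
    coeffTerm α t + coeff (f ++ g) α     ≈⟨ +-congˡ (coeff-++ f g α) ⟩
    coeffTerm α t + (coeff f α + coeff g α) ≈⟨ +-assoc _ _ _ ⟨
    (coeffTerm α t + coeff f α) + coeff g α ≈⟨ +-congʳ (coeff-∷ t f α) ⟨
    coeff (t ∷ f) α + coeff g α          ∎
    where open ≈-Reasoning

  -- _≋_ wrapped in a record, so that both polynomials can be inferred from a proof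
  infix 4 _≃_
  record _≃_ (f g : Polynomial) : Set (c ⊔ ℓ) where
    constructor coeffwise
    field coeff-≈ : f ≋ g
  open _≃_

  ≃-setoid : Setoid c (c ⊔ ℓ)
  ≃-setoid = record
    { Carrier       = Polynomial
    ; _≈_           = _≃_
    ; isEquivalence = record
      { refl  = coeffwise λ _ → refl
      ; sym   = λ f≃g → coeffwise λ α → sym (coeff-≈ f≃g α)
      ; trans = λ f≃g g≃h → coeffwise λ α → trans (coeff-≈ f≃g α) (coeff-≈ g≃h α)
      }
    }

  module ≃-Reasoning = SetoidReasoning ≃-setoid
  open Setoid ≃-setoid using () renaming (refl to ≃-refl; reflexive to ≃-reflexive)

  infix 4 _∼_
  data _∼_ : Polynomial → Polynomial → Set (c ⊔ ℓ) where
    []     : [] ∼ []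
    cons   : ∀ {x y a b f g} → x ≈ y → a ≡ b → f ∼ g → (x , a) ∷ f ∼ (y , b) ∷ g
    swap   : ∀ {t t′ f g} → f ∼ g → t ∷ t′ ∷ f ∼ t′ ∷ t ∷ g
    cancel : ∀ {x y a b f g} → x + y ≈ 0# → a ≡ b → f ∼ g → (x , a) ∷ (y , b) ∷ f ∼ g
    ∼-sym  : ∀ {f g} → f ∼ g → g ∼ f
    ∼-trans : ∀ {f g h} → f ∼ g → g ∼ h → f ∼ h

  ∼⇒≋ : ∀ {f g} → f ∼ g → f ≋ g
  ∼⇒≋ [] α = refl
  ∼⇒≋ (cons {x} {y} {a} {f = f} {g} x≈y ≡.refl f∼g) α = begin
    coeff ((x , a) ∷ f) α              ≈⟨ coeff-∷ (x , a) f α ⟩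
    coeffTerm α (x , a) + coeff f α    ≈⟨ +-cong (coeffTerm-cong α a x≈y) (∼⇒≋ f∼g α) ⟩
    coeffTerm α (y , a) + coeff g α    ≈⟨ coeff-∷ (y , a) g α ⟨
    coeff ((y , a) ∷ g) α              ∎
    where open ≈-Reasoning
  ∼⇒≋ (swap {t} {t′} {f} {g} f∼g) α = begin
    coeff (t ∷ t′ ∷ f) α                            ≈⟨ coeff-∷ t (t′ ∷ f) α ⟩
    coeffTerm α t + coeff (t′ ∷ f) α                ≈⟨ +-congˡ (coeff-∷ t′ f α) ⟩
    coeffTerm α t + (coeffTerm α t′ + coeff f α)    ≈⟨ x∙yz≈y∙xz _ _ _ ⟩
    coeffTerm α t′ + (coeffTerm α t + coeff f α)    ≈⟨ +-congˡ (+-congˡ (∼⇒≋ f∼g α)) ⟩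
    coeffTerm α t′ + (coeffTerm α t + coeff g α)    ≈⟨ +-congˡ (coeff-∷ t g α) ⟨
    coeffTerm α t′ + coeff (t ∷ g) α                ≈⟨ coeff-∷ t′ (t ∷ g) α ⟨
    coeff (t′ ∷ t ∷ g) α                            ∎
    where open ≈-Reasoning
  ∼⇒≋ (cancel {x} {y} {a} {f = f} {g} x+y≈0 ≡.refl f∼g) α = begin
    coeff ((x , a) ∷ (y , a) ∷ f) α                           ≈⟨ coeff-∷ (x , a) ((y , a) ∷ f) α ⟩
    coeffTerm α (x , a) + coeff ((y , a) ∷ f) α               ≈⟨ +-congˡ (coeff-∷ (y , a) f α) ⟩
    coeffTerm α (x , a) + (coeffTerm α (y , a) + coeff f α)   ≈⟨ +-assoc _ _ _ ⟨
    (coeffTerm α (x , a) + coeffTerm α (y , a)) + coeff f α   ≈⟨ +-cong (coeffTerm-cancel α a x+y≈0) (∼⇒≋ f∼g α) ⟩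
    0# + coeff g α                                            ≈⟨ +-identityˡ _ ⟩
    coeff g α                                                 ∎
    where open ≈-Reasoning
  ∼⇒≋ (∼-sym g∼f) α = sym (∼⇒≋ g∼f α)
  ∼⇒≋ (∼-trans f∼g g∼h) α = trans (∼⇒≋ f∼g α) (∼⇒≋ g∼h α)

  ++-cong : ∀ {f f′ g g′} → f ≃ f′ → g ≃ g′ → f ++ g ≃ f′ ++ g′
  ++-cong {f} {f′} {g} {g′} f≃f′ g≃g′ = coeffwise λ α → begin
    coeff (f ++ g) α              ≈⟨ coeff-++ f g α ⟩
    coeff f α + coeff g α         ≈⟨ +-cong (coeff-≈ f≃f′ α) (coeff-≈ g≃g′ α) ⟩
    coeff f′ α + coeff g′ α       ≈⟨ coeff-++ f′ g′ α ⟨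
    coeff (f′ ++ g′) α            ∎
    where open ≈-Reasoning

  ++-interchange : ∀ a b s l → (a ++ b) ++ (s ++ l) ≃ (a ++ s) ++ (b ++ l)
  ++-interchange a b s l = coeffwise λ α → begin
    coeff ((a ++ b) ++ (s ++ l)) α                              ≈⟨ coeff-++ (a ++ b) (s ++ l) α ⟩
    coeff (a ++ b) α + coeff (s ++ l) α                         ≈⟨ +-cong (coeff-++ a b α) (coeff-++ s l α) ⟩
    (coeff a α + coeff b α) + (coeff s α + coeff l α)           ≈⟨ interchange _ _ _ _ ⟩
    (coeff a α + coeff s α) + (coeff b α + coeff l α)           ≈⟨ +-cong (coeff-++ a s α) (coeff-++ b l α) ⟨
    coeff (a ++ s) α + coeff (b ++ l) α                         ≈⟨ coeff-++ (a ++ s) (b ++ l) α ⟨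
    coeff ((a ++ s) ++ (b ++ l)) α                              ∎
    where open ≈-Reasoning

  _*ₜ_ : Term → Term → Term
  s *ₜ t = proj₁ s * proj₁ t , proj₂ s +ᵐ proj₂ t

  _·_ : Term → Polynomial → Polynomial
  t · g = map (t *ₜ_) g

  Combination : Set c
  Combination = List (Term × Polynomial)

  _·∑_ : Term → Combination → Polynomial
  t ·∑ C = foldr (λ nh acc → (t *ₜ proj₁ nh) · proj₂ nh ++ acc) [] C

  combine : List (Polynomial × Polynomial) → Polynomial
  combine = foldr (λ qg acc → (proj₁ qg ⊗ proj₂ qg) ⊕ acc) zeroP

  scaled : Polynomial → Combination → List (Polynomial × Polynomial)
  scaled r = map (λ nh → r ⊗ (proj₁ nh ∷ []) , proj₂ nh)

  combine-scaled-[] : ∀ C → combine (scaled [] C) ≡ []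
  combine-scaled-[] []      = ≡.refl
  combine-scaled-[] (_ ∷ C) = combine-scaled-[] C

  combine-scaled-∷ : ∀ t r C → combine (scaled (t ∷ r) C) ≃ t ·∑ C ++ combine (scaled r C)
  combine-scaled-∷ t r []            = ≃-refl
  combine-scaled-∷ t r ((n , h) ∷ C) = begin
    (tn · h ++ rn ⊗ h) ++ combine (scaled (t ∷ r) C)        ≈⟨ ++-cong ≃-refl (combine-scaled-∷ t r C) ⟩
    (tn · h ++ rn ⊗ h) ++ (t ·∑ C ++ combine (scaled r C))
      ≈⟨ ++-interchange (tn · h) (rn ⊗ h) (t ·∑ C) (combine (scaled r C)) ⟩
    (tn · h ++ t ·∑ C) ++ (rn ⊗ h ++ combine (scaled r C))  ∎
    where
    open ≃-Reasoning
    tn : Term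
    tn = t *ₜ n
    rn : Polynomial
    rn = r ⊗ (n ∷ [])

  ⊗-combination : ∀ {g} C → (∀ t → t · g ∼ t ·∑ C) → ∀ r → r ⊗ g ≃ combine (scaled r C)
  ⊗-combination C expand []          = ≃-reflexive (≡.sym (combine-scaled-[] C))
  ⊗-combination {g} C expand (t ∷ r) = begin
    t · g ++ r ⊗ g                  ≈⟨ ++-cong (coeffwise (∼⇒≋ (expand t))) (⊗-combination C expand r) ⟩
    t ·∑ C ++ combine (scaled r C)  ≈⟨ combine-scaled-∷ t r C ⟨
    combine (scaled (t ∷ r) C)      ∎
    where open ≃-Reasoning

  combine-++ : ∀ qs rs → combine (qs ++ rs) ≃ combine qs ⊕ combine rs
  combine-++ []             rs = ≃-refl
  combine-++ ((q , g) ∷ qs) rs = begin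
    q ⊗ g ++ combine (qs ++ rs)          ≈⟨ ++-cong ≃-refl (combine-++ qs rs) ⟩
    q ⊗ g ++ (combine qs ++ combine rs)  ≡⟨ ListP.++-assoc (q ⊗ g) (combine qs) (combine rs) ⟨
    (q ⊗ g ++ combine qs) ++ combine rs  ∎
    where open ≃-Reasoning

  -- membership is stated for all multiples at once, as InIdeal is not visibly closed under ⊗
  ⟨_⟩∋_ : ∀ {p} → (Polynomial → Set p) → Polynomial → Set (c ⊔ ℓ ⊔ p)
  ⟨ S ⟩∋ h = ∀ r → InIdeal S (r ⊗ h)

  module _ {p} (S : Polynomial → Set p) where

    InIdeal-≃ : ∀ {f g} → f ≃ g → InIdeal S g → InIdeal S f
    InIdeal-≃ f≃g (qs , qs∈S , g≋) = qs , qs∈S , λ α → trans (coeff-≈ f≃g α) (g≋ α)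

    InIdeal-⊕ : ∀ {f g} → InIdeal S f → InIdeal S g → InIdeal S (f ⊕ g)
    InIdeal-⊕ {f} {g} (qs , qs∈S , f≋) (rs , rs∈S , g≋) =
      qs ++ rs , ++⁺ qs∈S rs∈S , coeff-≈ (begin
        f ++ g                    ≈⟨ ++-cong (coeffwise {f} {combine qs} f≋) (coeffwise {g} {combine rs} g≋) ⟩
        combine qs ++ combine rs  ≈⟨ combine-++ qs rs ⟨
        combine (qs ++ rs)        ∎)
      where open ≃-Reasoning

    generator∈ : ∀ {g} → S g → ⟨ S ⟩∋ g
    generator∈ {g} g∈S r = (r , g) ∷ [] , g∈S ∷ [] , coeff-≈ (≃-reflexive (≡.sym (ListP.++-identityʳ (r ⊗ g))))

    combination∈ : ∀ {g} C → All (λ nh → ⟨ S ⟩∋ proj₂ nh) C → (∀ t → t · g ∼ t ·∑ C) → ⟨ S ⟩∋ g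
    combination∈ C hs∈ expand r = InIdeal-≃ (⊗-combination C expand r) (sum∈ C hs∈)
      where
      sum∈ : ∀ C → All (λ nh → ⟨ S ⟩∋ proj₂ nh) C → InIdeal S (combine (scaled r C))
      sum∈ []            []          = [] , [] , λ _ → refl
      sum∈ ((n , h) ∷ C) (h∈ ∷ hs∈) =
        InIdeal-⊕ {(r ⊗ (n ∷ [])) ⊗ h} {combine (scaled r C)} (h∈ (r ⊗ (n ∷ []))) (sum∈ C hs∈)

  sameIdeal : ∀ {p q} {S : Polynomial → Set p} {T : Polynomial → Set q} →
              (∀ {g} → S g → ⟨ T ⟩∋ g) → (∀ {g} → T g → ⟨ S ⟩∋ g) → SameIdeal S T
  sameIdeal {S = S} {T} S⊆T T⊆S = ⊆ S T S⊆T , ⊆ T S T⊆S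
    where
    ⊆ : ∀ {p q} (S : Polynomial → Set p) (T : Polynomial → Set q) →
        (∀ {g} → S g → ⟨ T ⟩∋ g) → ∀ f → InIdeal S f → InIdeal T f
    ⊆ S T S⊆T f (qs , qs∈S , f≋) = InIdeal-≃ T (coeffwise {f} {combine qs} f≋) (sum∈ qs qs∈S)
      where
      sum∈ : ∀ qs → All (S ∘ proj₂) qs → InIdeal T (combine qs)
      sum∈ []             []            = [] , [] , λ _ → refl
      sum∈ ((q , g) ∷ qs) (g∈S ∷ qs∈S) = InIdeal-⊕ T {q ⊗ g} {combine qs} (S⊆T g∈S q) (sum∈ qs qs∈S)

  x*1+x*-1≈0 : ∀ x → x * 1# + x * - 1# ≈ 0#
  x*1+x*-1≈0 x = trans (sym (distribˡ x 1# (- 1#))) (trans (*-congˡ (-‿inverseʳ 1#)) (zeroʳ x))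

  module _ {p} {S : Polynomial → Set p} where

    binomial-self∈ : ∀ u → ⟨ S ⟩∋ binomial u u
    binomial-self∈ u = combination∈ S [] [] λ (x , a) → cancel (x*1+x*-1≈0 x) ≡.refl []

    binomial-swap∈ : ∀ u v → ⟨ S ⟩∋ binomial v u → ⟨ S ⟩∋ binomial u v
    binomial-swap∈ u v vu∈ = combination∈ S (((- 1# , Vec.replicate m 0) , binomial v u) ∷ []) (vu∈ ∷ []) λ (x , a) →
      ∼-trans (swap [])
        (cons (sym (*-identityʳ _)) (≡.cong (_+ᵐ v) (≡.sym (+ᵐ-identityʳ a)))
          (cons (sym (trans (*-assoc x (- 1#) (- 1#)) (*-congˡ (trans (-1*x≈-x (- 1#)) (-‿involutive 1#)))))
                (≡.cong (_+ᵐ u) (≡.sym (+ᵐ-identityʳ a))) []))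

    binomial-factor∈ : ∀ γ p q → ⟨ S ⟩∋ binomial p q → ⟨ S ⟩∋ binomial (γ +ᵐ p) (γ +ᵐ q)
    binomial-factor∈ γ p q pq∈ = combination∈ S (((1# , γ) , binomial p q) ∷ []) (pq∈ ∷ []) λ (x , a) →
      cons (*-congʳ (sym (*-identityʳ x))) (≡.sym (+ᵐ-assoc a γ p))
        (cons (*-congʳ (sym (*-identityʳ x))) (≡.sym (+ᵐ-assoc a γ q)) [])

    -- e^(u′+α) − e^(v′+β) = e^u′ (e^α − e^β) + e^β (e^u′ − e^v′)
    binomial-split∈ : ∀ u′ v′ α β → ⟨ S ⟩∋ binomial α β → ⟨ S ⟩∋ binomial u′ v′ →
                      ⟨ S ⟩∋ binomial (u′ +ᵐ α) (v′ +ᵐ β)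
    binomial-split∈ u′ v′ α β αβ∈ u′v′∈ =
      combination∈ S (((1# , u′) , binomial α β) ∷ ((1# , β) , binomial u′ v′) ∷ []) (αβ∈ ∷ u′v′∈ ∷ [])
        λ (x , a) →
        cons (sym (*-identityʳ _)) (≡.sym (+ᵐ-assoc a u′ α))
          (∼-sym (cancel (trans (+-comm _ _) (x*1+x*-1≈0 (x * 1#)))
                         (≡.trans (+ᵐ-assoc a u′ β) (≡.trans (≡.cong (a +ᵐ_) (+ᵐ-comm u′ β)) (≡.sym (+ᵐ-assoc a β u′))))
                   (cons (*-congʳ (*-identityʳ x))
                         (≡.trans (+ᵐ-assoc a β v′) (≡.cong (a +ᵐ_) (+ᵐ-comm β v′))) [])))

-- opened only here: the integer operations clash with the field operations used above
open ≡ using (refl; sym; trans; cong; cong₂; subst; subst₂; module ≡-Reasoning)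
open import Data.Integer as ℤ using (ℤ; +_; _+_; _-_; -_; _*_; _<_; 0ℤ; 1ℤ; -1ℤ)
import Data.Integer.Properties as ℤP
open import Data.Integer.Solver using (module +-*-Solver)
open +-*-Solver using (solve; _:+_; _:*_; _:-_; :-_; _:=_; con)

module ℕΣ = SemiringSum ℕP.+-*-semiring

open SemiringSum ℤP.+-*-semiring
  using (sum; sum-syntax; sum-cong-≗; ∑-distrib-+; ∑-comm; *-distribˡ-sum; sum-init-last; sum-replicate-zero)

foldr-tabulate : ∀ {a b} {A : Set a} {B : Set b} (_∙_ : A → B → B) (ε : B) {N} (g : Fin N → A) →
                 List.foldr _∙_ ε (List.tabulate g) ≡ Vector.foldr _∙_ ε g
foldr-tabulate _∙_ ε {zero}  g = refl
foldr-tabulate _∙_ ε {suc N} g = cong (g zero ∙_) (foldr-tabulate _∙_ ε (g ∘ suc))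

foldr-map-allFin : ∀ {a b} {A : Set a} {B : Set b} (_∙_ : A → B → B) (ε : B) {N} (f : Fin N → A) →
                   List.foldr _∙_ ε (List.map f (List.allFin N)) ≡ Vector.foldr _∙_ ε f
foldr-map-allFin _∙_ ε f =
  trans (cong (List.foldr _∙_ ε) (ListP.map-tabulate id f)) (foldr-tabulate _∙_ ε f)

∑-neg : ∀ {N} (f : Fin N → ℤ) → ∑[ i < N ] (- f i) ≡ - sum f
∑-neg {zero}  f = refl
∑-neg {suc N} f =
  trans (cong (λ x → - f zero + x) (∑-neg (f ∘ suc))) (sym (ℤP.neg-distrib-+ (f zero) _))

∑-sub : ∀ {N} (f g : Fin N → ℤ) → ∑[ i < N ] (f i - g i) ≡ sum f - sum g
∑-sub f g = trans (∑-distrib-+ f (λ i → - g i)) (cong (λ x → sum f + x) (∑-neg g))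

∑-select : ∀ {N} (f : Fin N → ℤ) (i : Fin N) → (∀ j → j ≢ i → f j ≡ 0ℤ) → sum f ≡ f i
∑-select {suc N} f zero f≡0 =
  trans (cong (λ x → f zero + x) (trans (sum-cong-≗ (λ j → f≡0 (suc j) λ ())) (sum-replicate-zero N)))
        (ℤP.+-identityʳ _)
∑-select {suc N} f (suc i) f≡0 =
  trans (cong (_+ sum (f ∘ suc)) (f≡0 zero λ ()))
  (trans (ℤP.+-identityˡ _)
         (∑-select (f ∘ suc) i (λ j j≢i → f≡0 (suc j) (j≢i ∘ FinP.suc-injective))))

∑-positive : ∀ {N} (f : Fin N → ℤ) → 0ℤ < sum f → ∃ λ i → 0ℤ < f i
∑-positive {zero}  f (ℤ.+<+ ())
∑-positive {suc N} f 0<∑ with 0ℤ ℤP.<? f zero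
... | yes 0<f₀ = zero , 0<f₀
... | no 0≮f₀ with 0ℤ ℤP.<? sum (f ∘ suc)
...   | yes 0<∑ᵗ = let i , 0<fᵢ = ∑-positive (f ∘ suc) 0<∑ᵗ in suc i , 0<fᵢ
...   | no 0≮∑ᵗ  = ⊥-elim (ℤP.<-irrefl refl
                      (ℤP.≤-<-trans (ℤP.+-mono-≤ (ℤP.≮⇒≥ 0≮f₀) (ℤP.≮⇒≥ 0≮∑ᵗ)) 0<∑))

+-∑ : ∀ {N} (f : Fin N → ℕ) → + ℕΣ.sum f ≡ ∑[ i < N ] (+ f i)
+-∑ {zero}  f = refl
+-∑ {suc N} f = trans (ℤP.pos-+ (f zero) _) (cong (λ x → + f zero + x) (+-∑ (f ∘ suc)))

∑-exchange : ∀ {N} (f g : Fin N → ℕ) (i : Fin N) → (∀ j → j ≢ i → f j ≡ g j) →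
             ℕΣ.sum f ℕ.+ g i ≡ ℕΣ.sum g ℕ.+ f i
∑-exchange f g zero f≡g rewrite ℕΣ.sum-cong-≗ (λ j → f≡g (suc j) λ ()) =
  trans (ℕP.+-comm (f zero ℕ.+ s) (g zero))
        (trans (cong (g zero ℕ.+_) (ℕP.+-comm (f zero) s)) (sym (ℕP.+-assoc (g zero) s (f zero))))
  where s = ℕΣ.sum (g ∘ suc)
∑-exchange f g (suc i) f≡g rewrite f≡g zero (λ ()) =
  trans (ℕP.+-assoc (g zero) _ _)
  (trans (cong (g zero ℕ.+_) (∑-exchange (f ∘ suc) (g ∘ suc) i (λ j j≢i → f≡g (suc j) (j≢i ∘ FinP.suc-injective))))
         (sym (ℕP.+-assoc (g zero) _ _)))

∑-lookup : ∀ {a} {A : Set a} (f : A → ℕ) (xs : List A) → ℕΣ.sum (f ∘ List.lookup xs) ≡ ListAction.sum (List.map f xs)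
∑-lookup f []       = refl
∑-lookup f (x ∷ xs) = cong (f x ℕ.+_) (∑-lookup f xs)

xor-cancelˡ : ∀ a b → a xor (a xor b) ≡ b
xor-cancelˡ a b = trans (sym (xor-assoc a a b)) (cong (_xor b) (xor-same a))

not-xor-shift : ∀ a b c → not (a xor c) xor (a xor b) ≡ not (b xor c)
not-xor-shift true  true  true  = refl
not-xor-shift true  true  false = refl
not-xor-shift true  false true  = refl
not-xor-shift true  false false = refl
not-xor-shift false true  true  = refl
not-xor-shift false true  false = refl
not-xor-shift false false true  = refl
not-xor-shift false false false = refl

σ : Bool → ℤ
σ b = if b then 1ℤ else -1ℤ

isPositive : Sign → Bool
isPositive s = does (s Sign.≟ Sign.+)

side-flip : ∀ a b s t → t Sign.* b ≡ Sign.opposite (s Sign.* a) →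
            isPositive s xor isPositive t ≡ does (a Sign.* b Sign.≟ Sign.+)
side-flip Sign.+ Sign.+ Sign.+ Sign.+ ()
side-flip Sign.+ Sign.+ Sign.+ Sign.- _ = refl
side-flip Sign.+ Sign.+ Sign.- Sign.+ _ = refl
side-flip Sign.+ Sign.+ Sign.- Sign.- ()
side-flip Sign.+ Sign.- Sign.+ Sign.+ _ = refl
side-flip Sign.+ Sign.- Sign.+ Sign.- ()
side-flip Sign.+ Sign.- Sign.- Sign.+ ()
side-flip Sign.+ Sign.- Sign.- Sign.- _ = refl
side-flip Sign.- Sign.+ Sign.+ Sign.+ _ = refl
side-flip Sign.- Sign.+ Sign.+ Sign.- ()
side-flip Sign.- Sign.+ Sign.- Sign.+ ()
side-flip Sign.- Sign.+ Sign.- Sign.- _ = refl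
side-flip Sign.- Sign.- Sign.+ Sign.+ ()
side-flip Sign.- Sign.- Sign.+ Sign.- _ = refl
side-flip Sign.- Sign.- Sign.- Sign.+ _ = refl
side-flip Sign.- Sign.- Sign.- Sign.- ()

sideOf : Bool → Sign
sideOf b = if b then Sign.+ else Sign.-

does-isPositive-≟ : ∀ s b → does (isPositive s Bool.≟ b) ≡ does (s Sign.≟ sideOf b)
does-isPositive-≟ Sign.+ true  = refl
does-isPositive-≟ Sign.+ false = refl
does-isPositive-≟ Sign.- true  = refl
does-isPositive-≟ Sign.- false = refl

module _ {n m : ℕ} (G : SignedGraph n m) where

  signℤ-* : ∀ t s → signℤ G t * signℤ G s ≡ signℤ G (s Sign.* t)
  signℤ-* Sign.+ Sign.+ = refl
  signℤ-* Sign.+ Sign.- = refl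
  signℤ-* Sign.- Sign.+ = refl
  signℤ-* Sign.- Sign.- = refl

  signℤ-opposite : ∀ x → signℤ G (Sign.opposite x) ≡ - signℤ G x
  signℤ-opposite Sign.+ = refl
  signℤ-opposite Sign.- = refl

  sign-flip : ∀ a b x → signℤ G a * σ x ≡ - (signℤ G b * σ (x xor does (a Sign.* b Sign.≟ Sign.+)))
  sign-flip Sign.+ Sign.+ true  = refl
  sign-flip Sign.+ Sign.+ false = refl
  sign-flip Sign.+ Sign.- true  = refl
  sign-flip Sign.+ Sign.- false = refl
  sign-flip Sign.- Sign.+ true  = refl
  sign-flip Sign.- Sign.+ false = refl
  sign-flip Sign.- Sign.- true  = refl
  sign-flip Sign.- Sign.- false = refl

-- next and prev live in the graph module of Defs, hence their (unused) graph argument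
module _ {n m : ℕ} (G : SignedGraph n m) where

  next-inject₁ : ∀ {k} (i : Fin k) → next G (inject₁ i) ≡ suc i
  next-inject₁ {k} i = toℕ-injective (begin
    toℕ (next G (inject₁ i))       ≡⟨ toℕ-fromℕ< _ ⟩
    suc (toℕ (inject₁ i)) % suc k  ≡⟨ cong (λ x → suc x % suc k) (toℕ-inject₁ i) ⟩
    suc (toℕ i) % suc k            ≡⟨ m<n⇒m%n≡m (s≤s (FinP.toℕ<n i)) ⟩
    suc (toℕ i)                    ∎)
    where open ≡-Reasoning

  next-fromℕ : ∀ k → next G (fromℕ k) ≡ zero
  next-fromℕ k = toℕ-injective (trans (toℕ-fromℕ< _) (trans (cong (λ x → suc x % suc k) (toℕ-fromℕ k)) (n%n≡0 (suc k))))

  prev-suc : ∀ {k} (i : Fin k) → prev G (suc i) ≡ inject₁ i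
  prev-suc {k} i = toℕ-injective (begin
    toℕ (prev G (suc i))         ≡⟨ toℕ-fromℕ< _ ⟩
    (suc (toℕ i) ℕ.+ k) % suc k  ≡⟨ cong (_% suc k) (sym (ℕP.+-suc (toℕ i) k)) ⟩
    (toℕ i ℕ.+ suc k) % suc k    ≡⟨ [m+n]%n≡m%n (toℕ i) (suc k) ⟩
    toℕ i % suc k                ≡⟨ m<n⇒m%n≡m (ℕP.m≤n⇒m≤1+n (FinP.toℕ<n i)) ⟩
    toℕ i                        ≡⟨ toℕ-inject₁ i ⟨
    toℕ (inject₁ i)              ∎)
    where open ≡-Reasoning

  prev-zero : ∀ k → prev G {k} zero ≡ fromℕ k
  prev-zero k = toℕ-injective (trans (toℕ-fromℕ< _) (trans (m<n⇒m%n≡m (ℕP.n<1+n k)) (sym (toℕ-fromℕ k))))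

  prev-next : ∀ {k} (i : Fin (suc k)) → prev G (next G i) ≡ i
  prev-next i with Top.view i
  ... | Top.‵fromℕ     = trans (cong (prev G) (next-fromℕ _)) (prev-zero _)
  ... | Top.‵inject₁ j = trans (cong (prev G) (next-inject₁ j)) (prev-suc j)

  ∑-next : ∀ {k} (f : Fin (suc k) → ℤ) → ∑[ i < suc k ] f (next G i) ≡ sum f
  ∑-next {k} f = begin
    ∑[ i < suc k ] f (next G i)                        ≡⟨ sum-init-last (f ∘ next G) ⟩
    ∑[ i < k ] f (next G (inject₁ i)) + f (next G (fromℕ k))
      ≡⟨ cong₂ _+_ (sum-cong-≗ (cong f ∘ next-inject₁)) (cong f (next-fromℕ k)) ⟩
    ∑[ i < k ] f (suc i) + f zero                      ≡⟨ ℤP.+-comm _ (f zero) ⟩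
    sum f                                              ∎
    where open ≡-Reasoning

-- Balanced sections

indicator : Bool → ℕ
indicator b = if b then 1 else 0

isEvenℕ-+-indicator : ∀ n b → isEvenℕ (n ℕ.+ indicator b) ≡ isEvenℕ n xor b
isEvenℕ-+-indicator n false = trans (cong isEvenℕ (ℕP.+-identityʳ n)) (sym (xor-identityʳ _))
isEvenℕ-+-indicator n true  = trans (cong isEvenℕ (ℕP.+-comm n 1)) (isEvenℕ-suc n)
  where
  isEvenℕ-suc : ∀ n → isEvenℕ (suc n) ≡ isEvenℕ n xor true
  isEvenℕ-suc zero          = refl
  isEvenℕ-suc (suc zero)    = refl
  isEvenℕ-suc (suc (suc n)) = isEvenℕ-suc n

isEvenℕ-double : ∀ j → isEvenℕ (2 ℕ.* j) ≡ true
isEvenℕ-double zero    = refl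
isEvenℕ-double (suc j) rewrite ℕP.+-suc j (j ℕ.+ 0) = isEvenℕ-double j

isEvenℕ⇒double : ∀ n → isEvenℕ n ≡ true → ∃ λ j → n ≡ 2 ℕ.* j
isEvenℕ⇒double zero          _ = 0 , refl
isEvenℕ⇒double (suc zero)    ()
isEvenℕ⇒double (suc (suc n)) e =
  let j , n≡2j = isEvenℕ⇒double n e in suc j , cong suc (trans (cong suc n≡2j) (sym (ℕP.+-suc j (j ℕ.+ 0))))

does-≤?-suc : ∀ a t → a ≢ suc t → does (a ℕ.≤? suc t) ≡ does (a ℕ.≤? t)
does-≤?-suc a t a≢1+t with a ℕ.≤? t
... | yes a≤t = trans (dec-true (a ℕ.≤? suc t) (ℕP.m≤n⇒m≤1+n a≤t)) (sym (dec-true (a ℕ.≤? t) a≤t))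
... | no  a≰t = trans (dec-false (a ℕ.≤? suc t) (λ a≤1+t → a≢1+t (ℕP.≤-antisym a≤1+t (ℕP.≰⇒> a≰t))))
                      (sym (dec-false (a ℕ.≤? t) a≰t))

module WalkParity {n m : ℕ} {G : SignedGraph n m} (w : ClosedWalk G) where
  open ClosedWalk w

  countF≡∑ : ∀ p → countF p ≡ ℕΣ.sum (indicator ∘ p)
  countF≡∑ p = foldr-map-allFin ℕ._+_ 0 (indicator ∘ p)

  unbalancedIn[1,_] : Fin (suc k) → Fin (suc k) → Bool
  unbalancedIn[1, i ] j = does (1 ℕ.≤? toℕ j) ∧ does (toℕ j ℕ.≤? toℕ i) ∧ unbalanced j

  unbalancedUpTo : Fin (suc k) → ℕ
  unbalancedUpTo i = countF unbalancedIn[1, i ]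

  unbalancedUpTo-zero : unbalancedUpTo zero ≡ 0
  unbalancedUpTo-zero =
    trans (countF≡∑ unbalancedIn[1, zero ])
          (trans (ℕΣ.sum-cong-≗ {x = indicator ∘ unbalancedIn[1, zero ]} {y = Vector.replicate (suc k) 0}
                                λ { zero → refl ; (suc j) → refl })
                 (ℕΣ.sum-replicate-zero (suc k)))

  unbalancedUpTo-suc : ∀ i → unbalancedUpTo (suc i) ≡ unbalancedUpTo (inject₁ i) ℕ.+ indicator (unbalanced (suc i))
  unbalancedUpTo-suc i = begin
    unbalancedUpTo (suc i)                     ≡⟨ countF≡∑ unbalancedIn[1, suc i ] ⟩
    ℕΣ.sum f                                   ≡⟨ ℕP.+-identityʳ _ ⟨
    ℕΣ.sum f ℕ.+ 0                             ≡⟨ cong (ℕΣ.sum f ℕ.+_) gᵢ ⟨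
    ℕΣ.sum f ℕ.+ g (suc i)                     ≡⟨ ∑-exchange f g (suc i) agree ⟩
    ℕΣ.sum g ℕ.+ f (suc i)                     ≡⟨ cong₂ ℕ._+_ (sym (countF≡∑ unbalancedIn[1, inject₁ i ])) fᵢ ⟩
    unbalancedUpTo (inject₁ i) ℕ.+ indicator (unbalanced (suc i)) ∎
    where
    open ≡-Reasoning
    f g : Fin (suc k) → ℕ
    f = indicator ∘ unbalancedIn[1, suc i ]
    g = indicator ∘ unbalancedIn[1, inject₁ i ]
    gᵢ : g (suc i) ≡ 0
    gᵢ rewrite dec-false (suc (toℕ i) ℕ.≤? toℕ (inject₁ i)) (ℕP.<-irrefl (sym (toℕ-inject₁ i))) = refl
    fᵢ : f (suc i) ≡ indicator (unbalanced (suc i))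
    fᵢ rewrite dec-true (suc (toℕ i) ℕ.≤? suc (toℕ i)) ℕP.≤-refl = refl
    agree : ∀ j → j ≢ suc i → f j ≡ g j
    agree j j≢1+i = cong (λ b → indicator (does (1 ℕ.≤? toℕ j) ∧ b ∧ unbalanced j))
      (trans (does-≤?-suc (toℕ j) (toℕ i) (j≢1+i ∘ toℕ-injective))
             (cong (λ x → does (toℕ j ℕ.≤? x)) (sym (toℕ-inject₁ i))))

  countF-unbalanced : countF unbalanced ≡ unbalancedUpTo (fromℕ k) ℕ.+ indicator (unbalanced zero)
  countF-unbalanced = begin
    countF unbalanced                    ≡⟨ countF≡∑ unbalanced ⟩
    ℕΣ.sum f                             ≡⟨ ℕP.+-identityʳ _ ⟨
    ℕΣ.sum f ℕ.+ g zero                  ≡⟨ ∑-exchange f g zero agree ⟩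
    ℕΣ.sum g ℕ.+ f zero                  ≡⟨ cong (ℕ._+ f zero) (countF≡∑ unbalancedIn[1, fromℕ k ]) ⟨
    unbalancedUpTo (fromℕ k) ℕ.+ f zero  ∎
    where
    open ≡-Reasoning
    f g : Fin (suc k) → ℕ
    f = indicator ∘ unbalanced
    g = indicator ∘ unbalancedIn[1, fromℕ k ]
    agree : ∀ j → j ≢ zero → f j ≡ g j
    agree zero    0≢0 = ⊥-elim (0≢0 refl)
    agree (suc j) _ rewrite dec-true (suc (toℕ j) ℕ.≤? toℕ (fromℕ k))
                              (subst (suc (toℕ j) ℕ.≤_) (sym (toℕ-fromℕ k)) (FinP.toℕ<n j)) = refl

  evenSection-zero : evenSection zero ≡ true
  evenSection-zero = cong isEvenℕ unbalancedUpTo-zero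

  evenSection-suc : ∀ i → evenSection (suc i) ≡ evenSection (inject₁ i) xor unbalanced (suc i)
  evenSection-suc i =
    trans (cong isEvenℕ (unbalancedUpTo-suc i)) (isEvenℕ-+-indicator (unbalancedUpTo (inject₁ i)) (unbalanced (suc i)))

  isEvenℕ-countF-unbalanced : isEvenℕ (countF unbalanced) ≡ evenSection (fromℕ k) xor unbalanced zero
  isEvenℕ-countF-unbalanced =
    trans (cong isEvenℕ countF-unbalanced) (isEvenℕ-+-indicator (unbalancedUpTo (fromℕ k)) (unbalanced zero))

  -- a 2-colouring of the balanced sections
  SectionLabelling : (Fin (suc k) → Bool) → Set
  SectionLabelling s = ∀ j → s (prev G j) xor s j ≡ unbalanced j

  evenSection-isLabelling : IsEven → SectionLabelling evenSection
  evenSection-isLabelling (j , even) zero = begin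
    evenSection (prev G zero) xor evenSection zero  ≡⟨ cong₂ _xor_ (cong evenSection (prev-zero G k)) evenSection-zero ⟩
    evenSection (fromℕ k) xor true                  ≡⟨ cong (evenSection (fromℕ k) xor_) total ⟨
    evenSection (fromℕ k) xor (evenSection (fromℕ k) xor unbalanced zero)
      ≡⟨ xor-cancelˡ (evenSection (fromℕ k)) (unbalanced zero) ⟩
    unbalanced zero                                 ∎
    where
    open ≡-Reasoning
    total : evenSection (fromℕ k) xor unbalanced zero ≡ true
    total = trans (sym isEvenℕ-countF-unbalanced) (trans (cong isEvenℕ even) (isEvenℕ-double j))
  evenSection-isLabelling _ (suc i) =
    trans (cong₂ _xor_ (cong evenSection (prev-suc G i)) (evenSection-suc i))
          (xor-cancelˡ (evenSection (inject₁ i)) (unbalanced (suc i)))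

  module _ {s : Fin (suc k) → Bool} (labelled : SectionLabelling s) where

    labelling-step : ∀ i → s (inject₁ i) xor s (suc i) ≡ unbalanced (suc i)
    labelling-step i = trans (cong (λ j → s j xor s (suc i)) (sym (prev-suc G i))) (labelled (suc i))

    evenSection≡ : ∀ i → evenSection i ≡ not (s i xor s zero)
    evenSection≡ = <-weakInduction (λ i → evenSection i ≡ not (s i xor s zero))
      (trans evenSection-zero (cong not (sym (xor-same (s zero)))))
      (λ i ih → begin
        evenSection (suc i)                                          ≡⟨ evenSection-suc i ⟩
        evenSection (inject₁ i) xor unbalanced (suc i)               ≡⟨ cong₂ _xor_ ih (sym (labelling-step i)) ⟩
        not (s (inject₁ i) xor s zero) xor (s (inject₁ i) xor s (suc i)) ≡⟨ not-xor-shift (s (inject₁ i)) (s (suc i)) (s zero) ⟩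
        not (s (suc i) xor s zero)                                   ∎)
      where open ≡-Reasoning

    labelling⇒IsEven : IsEven
    labelling⇒IsEven = isEvenℕ⇒double _ (begin
      isEvenℕ (countF unbalanced)                                ≡⟨ isEvenℕ-countF-unbalanced ⟩
      evenSection (fromℕ k) xor unbalanced zero                  ≡⟨ cong₂ _xor_ (evenSection≡ (fromℕ k)) (sym closing) ⟩
      not (s (fromℕ k) xor s zero) xor (s (fromℕ k) xor s zero)  ≡⟨ xor-inverseˡ (s (fromℕ k) xor s zero) ⟩
      true                                                       ∎)
      where
      open ≡-Reasoning
      closing : s (fromℕ k) xor s zero ≡ unbalanced zero
      closing = trans (cong (λ j → s j xor s zero) (sym (prev-zero G k))) (labelled zero)

δ : ∀ {N} → Fin N → ℤ → Fin N → ℤ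
δ i z j = if does (i Fin.≟ j) then z else 0ℤ

δ-self : ∀ {N} (i : Fin N) z → δ i z i ≡ z
δ-self i z = cong (if_then z else 0ℤ) (dec-true (i Fin.≟ i) refl)

∑-δ : ∀ {N} (i : Fin N) (h : Fin N → ℤ) z → ∑[ j < N ] (h j * δ i z j) ≡ h i * z
∑-δ i h z = trans (∑-select (λ j → h j * δ i z j) i off-i) (cong (h i *_) (δ-self i z))
  where
  off-i : ∀ j → j ≢ i → h j * δ i z j ≡ 0ℤ
  off-i j j≢i = trans (cong (λ b → h j * (if b then z else 0ℤ)) (dec-false (i Fin.≟ j) (j≢i ∘ sym)))
                      (ℤP.*-zeroʳ (h j))

_-ᵐ_ : ∀ {m} → Monomial m → Monomial m → Fin m → ℤ
(u -ᵐ v) e = + lookup u e - + lookup v e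

module Incidence {n m : ℕ} (G : SignedGraph n m) where
  open SignedGraph G

  A·_ : (Fin m → ℤ) → Fin n → ℤ
  (A· b) v = ∑[ e < m ] (incidence G v e * b e)

  InKernel⇒ : ∀ {b} → InKernel G b → ∀ v → (A· b) v ≡ 0ℤ
  InKernel⇒ {b} Ab≡0 v = trans (sym (foldr-map-allFin _+_ 0ℤ (λ e → incidence G v e * b e))) (Ab≡0 v)

  ⇒InKernel : ∀ {b} → (∀ v → (A· b) v ≡ 0ℤ) → InKernel G b
  ⇒InKernel {b} Ab≡0 v = trans (foldr-map-allFin _+_ 0ℤ (λ e → incidence G v e * b e)) (Ab≡0 v)

  _≈ᴬ_ : Monomial m → Monomial m → Set
  u ≈ᴬ v = ∀ x → (A· (u -ᵐ v)) x ≡ 0ℤ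

  A·-cong : ∀ {b c} → (∀ e → b e ≡ c e) → ∀ v → (A· b) v ≡ (A· c) v
  A·-cong b≗c v = sum-cong-≗ (cong (incidence G v _ *_) ∘ b≗c)

  A·-neg : ∀ b v → (A· (λ e → - b e)) v ≡ - (A· b) v
  A·-neg b v = trans (sum-cong-≗ (λ e → sym (ℤP.neg-distribʳ-* (incidence G v e) (b e)))) (∑-neg (λ e → incidence G v e * b e))

  A·-sub : ∀ b c v → (A· (λ e → b e - c e)) v ≡ (A· b) v - (A· c) v
  A·-sub b c v =
    trans (sum-cong-≗ (λ e → trans (ℤP.*-distribˡ-+ (incidence G v e) (b e) (- c e))
                                   (cong (λ x → incidence G v e * b e + x) (sym (ℤP.neg-distribʳ-* (incidence G v e) (c e))))))
          (∑-sub (λ e → incidence G v e * b e) (λ e → incidence G v e * c e))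

  ≈ᴬ-sym : ∀ {u v} → u ≈ᴬ v → v ≈ᴬ u
  ≈ᴬ-sym {u} {v} u≈ᴬv x = trans (A·-cong swap x) (trans (A·-neg (u -ᵐ v) x) (cong -_ (u≈ᴬv x)))
    where
    swap : ∀ e → (v -ᵐ u) e ≡ - (u -ᵐ v) e
    swap e = solve 2 (λ a b → b :- a := :- (a :- b)) refl (+ lookup u e) (+ lookup v e)

  ≈ᴬ-∸ᵐ : ∀ {u v α β} → u ≈ᴬ v → α ≈ᴬ β → α ≤ᵐ u → β ≤ᵐ v → (u ∸ᵐ α) ≈ᴬ (v ∸ᵐ β)
  ≈ᴬ-∸ᵐ {u} {v} {α} {β} u≈ᴬv α≈ᴬβ α≤u β≤v x =
    trans (A·-cong difference x) (trans (A·-sub (u -ᵐ v) (α -ᵐ β) x) (cong₂ _-_ (u≈ᴬv x) (α≈ᴬβ x)))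
    where
    +-∸ : ∀ a b → b ℕ.≤ a → + (a ℕ.∸ b) ≡ + a - + b
    +-∸ a b b≤a = sym (trans (ℤP.m-n≡m⊖n a b) (ℤP.⊖-≥ b≤a))
    difference : ∀ e → ((u ∸ᵐ α) -ᵐ (v ∸ᵐ β)) e ≡ (u -ᵐ v) e - (α -ᵐ β) e
    difference e =
      trans (cong₂ (λ p q → + p - + q) (VecP.lookup-zipWith ℕ._∸_ e u α) (VecP.lookup-zipWith ℕ._∸_ e v β))
      (trans (cong₂ _-_ (+-∸ (lookup u e) (lookup α e) (α≤u e)) (+-∸ (lookup v e) (lookup β e) (β≤v e)))
             (solve 4 (λ a b p q → (a :- p) :- (b :- q) := (a :- b) :- (p :- q)) refl
                      (+ lookup u e) (+ lookup v e) (+ lookup α e) (+ lookup β e)))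

  A·-δ : ∀ e z v → (A· δ e z) v ≡ incidence G v e * z
  A·-δ e z v = ∑-δ e (incidence G v) z

  A·-update : ∀ b e z v → (A· (λ f → b f - δ e z f)) v ≡ (A· b) v - incidence G v e * z
  A·-update b e z v = trans (A·-sub b (δ e z) v) (cong (λ x → (A· b) v - x) (A·-δ e z v))

  A·-∑δ : ∀ {t} (edg : Fin t → Fin m) (c : Fin t → ℤ) v →
          (A· (λ e → ∑[ i < t ] δ (edg i) (c i) e)) v ≡ ∑[ i < t ] (incidence G v (edg i) * c i)
  A·-∑δ {t} edg c v = begin
    ∑[ e < m ] (incidence G v e * ∑[ i < t ] δ (edg i) (c i) e)
      ≡⟨ sum-cong-≗ (λ e → *-distribˡ-sum (incidence G v e) (λ i → δ (edg i) (c i) e)) ⟩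
    ∑[ e < m ] ∑[ i < t ] (incidence G v e * δ (edg i) (c i) e)  ≡⟨ ∑-comm (λ e i → incidence G v e * δ (edg i) (c i) e) ⟩
    ∑[ i < t ] ∑[ e < m ] (incidence G v e * δ (edg i) (c i) e)
      ≡⟨ sum-cong-≗ (λ i → ∑-δ (edg i) (incidence G v) (c i)) ⟩
    ∑[ i < t ] (incidence G v (edg i) * c i)                     ∎
    where open ≡-Reasoning

  SameEnds⇒≢ : ∀ {e a b} → SameEnds (ends e) (a , b) → a ≢ b
  SameEnds⇒≢ {e} (inj₁ (refl , refl)) = loopless e
  SameEnds⇒≢ {e} (inj₂ (refl , refl)) = loopless e ∘ sym

  incident-joins : ∀ {e a b} → SameEnds (ends e) (a , b) → ∀ v → incident G v e ≡ does (v Fin.≟ a) ∨ does (v Fin.≟ b)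
  incident-joins (inj₁ (refl , refl)) v = refl
  incident-joins {e} (inj₂ (refl , refl)) v = ∨-comm (does (v Fin.≟ proj₁ (ends e))) (does (v Fin.≟ proj₂ (ends e)))

  incidence-joins : ∀ {e a b} → SameEnds (ends e) (a , b) →
                    ∀ v → incidence G v e ≡ δ v (signℤ G (τ e a)) a + δ v (signℤ G (τ e b)) b
  incidence-joins {e} {a} {b} a-e-b v =
    trans (cong (if_then signℤ G (τ e v) else 0ℤ) (incident-joins a-e-b v)) (split (v Fin.≟ a) (v Fin.≟ b))
    where
    split : (v≟a : Dec (v ≡ a)) (v≟b : Dec (v ≡ b)) →
            (if does v≟a ∨ does v≟b then signℤ G (τ e v) else 0ℤ) ≡
            (if does v≟a then signℤ G (τ e a) else 0ℤ) + (if does v≟b then signℤ G (τ e b) else 0ℤ)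
    split (yes refl) (yes refl) = ⊥-elim (SameEnds⇒≢ a-e-b refl)
    split (yes refl) (no _)     = sym (ℤP.+-identityʳ _)
    split (no _)     (yes refl) = sym (ℤP.+-identityˡ _)
    split (no _)     (no _)     = refl

-- Even closed walks give kernel elements

indicator-∧-difference : ∀ d b →
  + indicator (d ∧ does (b Bool.≟ true)) - + indicator (d ∧ does (b Bool.≟ false)) ≡ (if d then σ b else 0ℤ)
indicator-∧-difference true  true  = refl
indicator-∧-difference true  false = refl
indicator-∧-difference false true  = refl
indicator-∧-difference false false = refl

δ-*-neg : ∀ {N} (v a : Fin N) {x y s t} → x * s ≡ - (y * t) → δ v x a * s ≡ - (δ v y a * t)
δ-*-neg v a {s = s} {t} xs≡-yt with does (v Fin.≟ a)
... | true  = xs≡-yt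
... | false = sym (cong -_ (ℤP.*-zeroˡ t))

module SignedEdgeVector {n m : ℕ} {G : SignedGraph n m} (w : ClosedWalk G) where
  open ClosedWalk w
  open SignedGraph G
  open Incidence G
  open WalkParity w

  signedEdgeVector : (Fin (suc k) → Bool) → Fin m → ℤ
  signedEdgeVector s e = ∑[ i < suc k ] δ (edg i) (σ (s i)) e

  module _ {s : Fin (suc k) → Bool} (labelled : SectionLabelling s) where

    turn : ∀ j → signℤ G (τ (edg (prev G j)) (vtx j)) * σ (s (prev G j)) ≡ - (signℤ G (τ (edg j) (vtx j)) * σ (s j))
    turn j = trans (sign-flip G (τ (edg (prev G j)) (vtx j)) (τ (edg j) (vtx j)) (s (prev G j)))
                   (cong (λ b → - (signℤ G (τ (edg j) (vtx j)) * σ b))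
                         (trans (cong (s (prev G j) xor_) (sym (labelled j))) (xor-cancelˡ (s (prev G j)) (s j))))

    signedEdgeVector-inKernel : ∀ v → (A· signedEdgeVector s) v ≡ 0ℤ
    signedEdgeVector-inKernel v = begin
      (A· signedEdgeVector s) v                           ≡⟨ A·-∑δ edg (σ ∘ s) v ⟩
      ∑[ i < suc k ] (incidence G v (edg i) * σ (s i))    ≡⟨ sum-cong-≗ split ⟩
      ∑[ i < suc k ] (leave i + arrive i)                 ≡⟨ ∑-distrib-+ leave arrive ⟩
      sum leave + sum arrive                              ≡⟨ cong (λ x → sum leave + x) (sum-cong-≗ arrive≡) ⟩
      sum leave + ∑[ i < suc k ] (- leave (next G i))     ≡⟨ cong (λ x → sum leave + x) (∑-neg (leave ∘ next G)) ⟩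
      sum leave - ∑[ i < suc k ] leave (next G i)         ≡⟨ cong (λ x → sum leave - x) (∑-next G leave) ⟩
      sum leave - sum leave                               ≡⟨ ℤP.+-inverseʳ (sum leave) ⟩
      0ℤ                                                  ∎
      where
      open ≡-Reasoning
      leave arrive : Fin (suc k) → ℤ
      leave  i = δ v (signℤ G (τ (edg i) (vtx i))) (vtx i) * σ (s i)
      arrive i = δ v (signℤ G (τ (edg i) (vtx (next G i)))) (vtx (next G i)) * σ (s i)
      split : ∀ i → incidence G v (edg i) * σ (s i) ≡ leave i + arrive i
      split i = trans (cong (_* σ (s i)) (incidence-joins (joins i) v)) (ℤP.*-distribʳ-+ (σ (s i))
                  (δ v (signℤ G (τ (edg i) (vtx i))) (vtx i)) (δ v (signℤ G (τ (edg i) (vtx (next G i)))) (vtx (next G i))))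
      arrive≡ : ∀ i → arrive i ≡ - leave (next G i)
      arrive≡ i = δ-*-neg v (vtx (next G i))
        (subst (λ p → signℤ G (τ (edg p) (vtx (next G i))) * σ (s p)
                        ≡ - (signℤ G (τ (edg (next G i)) (vtx (next G i))) * σ (s (next G i))))
               (prev-next G i) (turn (next G i)))

  edgeMonomial-difference : ∀ e → (edgeMonomial true -ᵐ edgeMonomial false) e ≡ signedEdgeVector evenSection e
  edgeMonomial-difference e = begin
    + lookup (edgeMonomial true) e - + lookup (edgeMonomial false) e
      ≡⟨ cong₂ (λ x y → + x - + y) (VecP.lookup∘tabulate _ e) (VecP.lookup∘tabulate _ e) ⟩
    + countF (countAt true) - + countF (countAt false)
      ≡⟨ cong₂ (λ x y → + x - + y) (countF≡∑ (countAt true)) (countF≡∑ (countAt false)) ⟩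
    + ℕΣ.sum (indicator ∘ countAt true) - + ℕΣ.sum (indicator ∘ countAt false)
      ≡⟨ cong₂ _-_ (+-∑ (indicator ∘ countAt true)) (+-∑ (indicator ∘ countAt false)) ⟩
    sum (λ i → + indicator (countAt true i)) - sum (λ i → + indicator (countAt false i))
      ≡⟨ ∑-sub (λ i → + indicator (countAt true i)) (λ i → + indicator (countAt false i)) ⟨
    ∑[ i < suc k ] (+ indicator (countAt true i) - + indicator (countAt false i))
      ≡⟨ sum-cong-≗ (λ i → indicator-∧-difference (does (edg i Fin.≟ e)) (evenSection i)) ⟩
    signedEdgeVector evenSection e
      ∎
    where
    open ≡-Reasoning
    countAt : Bool → Fin (suc k) → Bool
    countAt b i = does (edg i Fin.≟ e) ∧ does (evenSection i Bool.≟ b)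

  evenWalk-≈ᴬ : IsEven → edgeMonomial true ≈ᴬ edgeMonomial false
  evenWalk-≈ᴬ even v =
    trans (A·-cong edgeMonomial-difference v) (signedEdgeVector-inKernel {evenSection} (evenSection-isLabelling even) v)

∣+-+⊔0∣ : ∀ a c → ℤ.∣ (+ a - + c) ℤ.⊔ 0ℤ ∣ ≡ a ℕ.∸ c
∣+-+⊔0∣ a c = trans (cong (λ z → ℤ.∣ z ℤ.⊔ 0ℤ ∣) (ℤP.m-n≡m⊖n a c)) (go a c)
  where
  go : ∀ a c → ℤ.∣ (a ℤ.⊖ c) ℤ.⊔ 0ℤ ∣ ≡ a ℕ.∸ c
  go zero    zero    = refl
  go zero    (suc c) = refl
  go (suc a) zero    = refl
  go (suc a) (suc c) = trans (cong (λ z → ℤ.∣ z ℤ.⊔ 0ℤ ∣) (ℤP.[1+m]⊖[1+n]≡m⊖n a c)) (go a c)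

∣+-+⊓0∣ : ∀ a c → ℤ.∣ (+ a - + c) ℤ.⊓ 0ℤ ∣ ≡ c ℕ.∸ a
∣+-+⊓0∣ a c = trans (cong (λ z → ℤ.∣ z ℤ.⊓ 0ℤ ∣) (ℤP.m-n≡m⊖n a c)) (go a c)
  where
  go : ∀ a c → ℤ.∣ (a ℤ.⊖ c) ℤ.⊓ 0ℤ ∣ ≡ c ℕ.∸ a
  go zero    zero    = refl
  go zero    (suc c) = refl
  go (suc a) zero    = refl
  go (suc a) (suc c) = trans (cong (λ z → ℤ.∣ z ℤ.⊓ 0ℤ ∣) (ℤP.[1+m]⊖[1+n]≡m⊖n a c)) (go a c)

+∣⊔0∣-+∣⊓0∣ : ∀ z → + ℤ.∣ z ℤ.⊔ 0ℤ ∣ - + ℤ.∣ z ℤ.⊓ 0ℤ ∣ ≡ z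
+∣⊔0∣-+∣⊓0∣ (+ zero)   = refl
+∣⊔0∣-+∣⊓0∣ (+ suc a)  = cong (λ x → + suc x) (ℕP.+-identityʳ a)
+∣⊔0∣-+∣⊓0∣ ℤ.-[1+ a ] = refl

module Toric {n m : ℕ} (G : SignedGraph n m) where
  open Incidence G

  InKernel⇒≈ᴬ : ∀ {b} → InKernel G b → posPart G b ≈ᴬ negPart G b
  InKernel⇒≈ᴬ {b} b∈ker x = trans (A·-cong b⁺-b⁻ x) (InKernel⇒ b∈ker x)
    where
    b⁺-b⁻ : ∀ e → (posPart G b -ᵐ negPart G b) e ≡ b e
    b⁺-b⁻ e = trans (cong₂ (λ p q → + p - + q) (VecP.lookup∘tabulate _ e) (VecP.lookup∘tabulate _ e))
                    (+∣⊔0∣-+∣⊓0∣ (b e))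

  split-posPart : ∀ α β → α ≡ Vec.zipWith ℕ._⊓_ α β +ᵐ posPart G (α -ᵐ β)
  split-posPart α β = lookup-ext λ e → sym (begin
    lookup (Vec.zipWith ℕ._⊓_ α β +ᵐ posPart G (α -ᵐ β)) e
      ≡⟨ VecP.lookup-zipWith ℕ._+_ e (Vec.zipWith ℕ._⊓_ α β) (posPart G (α -ᵐ β)) ⟩
    lookup (Vec.zipWith ℕ._⊓_ α β) e ℕ.+ lookup (posPart G (α -ᵐ β)) e
      ≡⟨ cong₂ ℕ._+_ (VecP.lookup-zipWith ℕ._⊓_ e α β) (VecP.lookup∘tabulate _ e) ⟩
    lookup α e ℕ.⊓ lookup β e ℕ.+ ℤ.∣ (α -ᵐ β) e ℤ.⊔ 0ℤ ∣
      ≡⟨ cong₂ ℕ._+_ (ℕP.⊓-comm (lookup α e) (lookup β e)) (∣+-+⊔0∣ (lookup α e) (lookup β e)) ⟩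
    lookup β e ℕ.⊓ lookup α e ℕ.+ (lookup α e ℕ.∸ lookup β e)
      ≡⟨ ℕP.m⊓n+n∸m≡n (lookup β e) (lookup α e) ⟩
    lookup α e ∎)
    where open ≡-Reasoning

  split-negPart : ∀ α β → β ≡ Vec.zipWith ℕ._⊓_ α β +ᵐ negPart G (α -ᵐ β)
  split-negPart α β = lookup-ext λ e → sym (begin
    lookup (Vec.zipWith ℕ._⊓_ α β +ᵐ negPart G (α -ᵐ β)) e
      ≡⟨ VecP.lookup-zipWith ℕ._+_ e (Vec.zipWith ℕ._⊓_ α β) (negPart G (α -ᵐ β)) ⟩
    lookup (Vec.zipWith ℕ._⊓_ α β) e ℕ.+ lookup (negPart G (α -ᵐ β)) e
      ≡⟨ cong₂ ℕ._+_ (VecP.lookup-zipWith ℕ._⊓_ e α β) (VecP.lookup∘tabulate _ e) ⟩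
    lookup α e ℕ.⊓ lookup β e ℕ.+ ℤ.∣ (α -ᵐ β) e ℤ.⊓ 0ℤ ∣
      ≡⟨ cong (lookup α e ℕ.⊓ lookup β e ℕ.+_) (∣+-+⊓0∣ (lookup α e) (lookup β e)) ⟩
    lookup α e ℕ.⊓ lookup β e ℕ.+ (lookup β e ℕ.∸ lookup α e)
      ≡⟨ ℕP.m⊓n+n∸m≡n (lookup α e) (lookup β e) ⟩
    lookup β e ∎)
    where open ≡-Reasoning

-- Greedy closed walks inside a kernel element

record Step (n m : ℕ) : Set where
  constructor step
  field
    vertex : Fin n
    edge   : Fin m
    side   : Sign

pick : ∀ {a} {A : Set a} → Sign → A → A → A
pick Sign.+ x y = x
pick Sign.- x y = y

module GreedyTrail {n m : ℕ} (G : SignedGraph n m) where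
  open SignedGraph G
  open Incidence G

  -- a step on side + uses up a unit of u, a step on side - a unit of v
  Available : Sign → Fin m → Monomial m → Monomial m → Set
  Available s e u v = 1 ℕ.≤ pick s (lookup u e) (lookup v e)

  decrementˡ decrementʳ : Sign → Fin m → Monomial m → Monomial m
  decrementˡ s e u = pick s (Vec.updateAt u e ℕ.pred) u
  decrementʳ s e v = pick s v (Vec.updateAt v e ℕ.pred)

  size-decrement : ∀ s e u v → Available s e u v → suc (size (decrementˡ s e u) (decrementʳ s e v)) ≡ size u v
  size-decrement Sign.+ e u v avail = cong (ℕ._+ degree v) (degree-decrement u e avail)
  size-decrement Sign.- e u v avail = trans (sym (ℕP.+-suc (degree u) _)) (cong (degree u ℕ.+_) (degree-decrement v e avail))

  decrement-difference : ∀ s e u v → Available s e u v → ∀ f →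
    (decrementˡ s e u -ᵐ decrementʳ s e v) f ≡ (u -ᵐ v) f - δ e (signℤ G s) f
  decrement-difference Sign.+ e u v avail f with e Fin.≟ f
  ... | yes refl rewrite VecP.lookup∘updateAt e {ℕ.pred} u with lookup u e | avail
  ...   | suc a | _ = solve 2 (λ x y → x :- y := ((con 1ℤ :+ x) :- y) :- con 1ℤ) refl (+ a) (+ lookup v e)
  decrement-difference Sign.+ e u v avail f | no e≢f
    rewrite VecP.lookup∘updateAt′ f e {ℕ.pred} (e≢f ∘ sym) u = sym (ℤP.+-identityʳ _)
  decrement-difference Sign.- e u v avail f with e Fin.≟ f
  ... | yes refl rewrite VecP.lookup∘updateAt e {ℕ.pred} v with lookup v e | avail
  ...   | suc a | _ = solve 2 (λ x y → x :- y := (x :- (con 1ℤ :+ y)) :- con -1ℤ) refl (+ lookup u e) (+ a)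
  decrement-difference Sign.- e u v avail f | no e≢f
    rewrite VecP.lookup∘updateAt′ f e {ℕ.pred} (e≢f ∘ sym) v = sym (ℤP.+-identityʳ _)

  A·-decrement : ∀ s e u v → Available s e u v → ∀ w →
    (A· (decrementˡ s e u -ᵐ decrementʳ s e v)) w ≡ (A· (u -ᵐ v)) w - incidence G w e * signℤ G s
  A·-decrement s e u v avail w =
    trans (A·-cong (decrement-difference s e u v avail) w) (A·-update (u -ᵐ v) e (signℤ G s) w)

  incident⇒SameEnds : ∀ e c → incident G c e ≡ true → ∃ λ o → SameEnds (ends e) (c , o)
  incident⇒SameEnds e c incident-ce with c Fin.≟ proj₁ (ends e) | c Fin.≟ proj₂ (ends e)
  ... | yes c≡a | _       = proj₂ (ends e) , inj₁ (sym c≡a , refl)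
  ... | no _    | yes c≡b = proj₁ (ends e) , inj₂ (refl , sym c≡b)

  incidence-positive : ∀ y c e z → 0ℤ < signℤ G y * (incidence G c e * z) →
                       incident G c e ≡ true × 0ℤ < signℤ G y * (signℤ G (τ e c) * z)
  incidence-positive y c e z 0< with incident G c e
  ... | true  = refl , 0<
  ... | false =
    ⊥-elim (ℤP.<-irrefl refl (subst (0ℤ <_) (trans (cong (signℤ G y *_) (ℤP.*-zeroˡ z)) (ℤP.*-zeroʳ (signℤ G y))) 0<))

  positive⇒1≤ : ∀ a b → 0ℤ < + a - + b → 1 ℕ.≤ a
  positive⇒1≤ (suc a) b       _ = s≤s z≤n
  positive⇒1≤ zero    zero    (ℤ.+<+ ())
  positive⇒1≤ zero    (suc b) ()

  negative⇒1≤ : ∀ a b → 0ℤ < - (+ a - + b) → 1 ℕ.≤ b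
  negative⇒1≤ a       (suc b) _ = s≤s z≤n
  negative⇒1≤ zero    zero    (ℤ.+<+ ())
  negative⇒1≤ (suc a) zero    ()

  available-side : ∀ y t a b → 0ℤ < signℤ G y * (signℤ G t * (+ a - + b)) → ∃ λ s → s Sign.* t ≡ y × 1 ℕ.≤ pick s a b
  available-side Sign.+ Sign.+ a b 0< =
    Sign.+ , refl , positive⇒1≤ a b (subst (0ℤ <_) (trans (ℤP.*-identityˡ _) (ℤP.*-identityˡ _)) 0<)
  available-side Sign.+ Sign.- a b 0< =
    Sign.- , refl , negative⇒1≤ a b (subst (0ℤ <_) (trans (ℤP.*-identityˡ _) (ℤP.-1*i≡-i _)) 0<)
  available-side Sign.- Sign.+ a b 0< =
    Sign.- , refl , negative⇒1≤ a b (subst (0ℤ <_) (trans (ℤP.-1*i≡-i _) (cong -_ (ℤP.*-identityˡ _))) 0<)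
  available-side Sign.- Sign.- a b 0< =
    Sign.+ , refl , positive⇒1≤ a b
      (subst (0ℤ <_) (trans (ℤP.-1*i≡-i _) (trans (cong -_ (ℤP.-1*i≡-i _)) (ℤP.neg-involutive _))) 0<)

  uses : Sign → Fin m → List (Step n m) → ℕ
  uses s e = ListAction.sum ∘ List.map (λ st → indicator (does (Step.edge st Fin.≟ e) ∧ does (Step.side st Sign.≟ s)))

  uses-own-step : ∀ c e s L → 1 ℕ.≤ uses s e (step c e s ∷ L)
  uses-own-step c e s L rewrite dec-true (e Fin.≟ e) refl | dec-true (s Sign.≟ s) refl = s≤s z≤n

  uses-decrement : ∀ s′ e′ u v → Available s′ e′ u v → ∀ s e →
    indicator (does (e′ Fin.≟ e) ∧ does (s′ Sign.≟ s))
      ℕ.+ pick s (lookup (decrementˡ s′ e′ u) e) (lookup (decrementʳ s′ e′ v) e)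
    ≡ pick s (lookup u e) (lookup v e)
  uses-decrement s′ e′ u v avail s e with e′ Fin.≟ e
  uses-decrement Sign.+ e′ u v avail Sign.+ e | yes refl =
    trans (cong suc (VecP.lookup∘updateAt e′ u)) (ℕP.suc-pred _ {{ℕ.>-nonZero avail}})
  uses-decrement Sign.- e′ u v avail Sign.- e | yes refl =
    trans (cong suc (VecP.lookup∘updateAt e′ v)) (ℕP.suc-pred _ {{ℕ.>-nonZero avail}})
  uses-decrement Sign.+ e′ u v avail Sign.- e | yes refl = refl
  uses-decrement Sign.- e′ u v avail Sign.+ e | yes refl = refl
  uses-decrement Sign.+ e′ u v avail Sign.+ e | no e′≢e = VecP.lookup∘updateAt′ e e′ (e′≢e ∘ sym) u
  uses-decrement Sign.- e′ u v avail Sign.- e | no e′≢e = VecP.lookup∘updateAt′ e e′ (e′≢e ∘ sym) v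
  uses-decrement Sign.+ e′ u v avail Sign.- e | no e′≢e = refl
  uses-decrement Sign.- e′ u v avail Sign.+ e | no e′≢e = refl

  module _ (v₀ : Fin n) (d₀ : Sign) where

    -- what is left of (u , v) after a trail leaving v₀ with sign d₀ has arrived at c with sign x
    Remains : Fin n → Sign → Monomial m → Monomial m → Set
    Remains c x u v = ∀ w → (A· (u -ᵐ v)) w ≡ - δ w (signℤ G d₀) v₀ - δ w (signℤ G x) c

    remains-step : ∀ {c x u v} e s o → SameEnds (ends e) (c , o) → s Sign.* τ e c ≡ Sign.opposite x →
                   Available s e u v → Remains c x u v →
                   Remains o (s Sign.* τ e o) (decrementˡ s e u) (decrementʳ s e v)
    remains-step {c} {x} {u} {v} e s o c-e-o turn avail rem w =
      trans (A·-decrement s e u v avail w)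
        (trans (cong₂ (λ p q → p - q * signℤ G s) (rem w) (incidence-joins c-e-o w))
               (move (w Fin.≟ c) (w Fin.≟ o)))
      where
      A : ℤ
      A = - δ w (signℤ G d₀) v₀
      leave : signℤ G (τ e c) * signℤ G s ≡ - signℤ G x
      leave = trans (signℤ-* G (τ e c) s) (trans (cong (signℤ G) turn) (signℤ-opposite G x))
      move : (w≟c : Dec (w ≡ c)) (w≟o : Dec (w ≡ o)) →
             (A - (if does w≟c then signℤ G x else 0ℤ))
               - ((if does w≟c then signℤ G (τ e c) else 0ℤ) + (if does w≟o then signℤ G (τ e o) else 0ℤ)) * signℤ G s
             ≡ A - (if does w≟o then signℤ G (s Sign.* τ e o) else 0ℤ)
      move (yes refl) (yes w≡o) = ⊥-elim (SameEnds⇒≢ c-e-o w≡o)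
      move (yes refl) (no _)    =
        trans (cong (λ z → (A - signℤ G x) - z) (trans (cong (_* signℤ G s) (ℤP.+-identityʳ (signℤ G (τ e c)))) leave))
              (solve 2 (λ a x → (a :- x) :- (:- x) := a :- con 0ℤ) refl A (signℤ G x))
      move (no _)     (yes refl) =
        trans (cong (λ z → (A - 0ℤ) - z) (trans (cong (_* signℤ G s) (ℤP.+-identityˡ (signℤ G (τ e o)))) (signℤ-* G (τ e o) s)))
              (cong (_- signℤ G (s Sign.* τ e o)) (ℤP.+-identityʳ A))
      move (no _)     (no _)    = solve 2 (λ a s → (a :- con 0ℤ) :- (con 0ℤ :+ con 0ℤ) :* s := a :- con 0ℤ) refl A (signℤ G s)

    Closes : Fin n → Sign → Set
    Closes c x = c ≡ v₀ × x ≡ Sign.opposite d₀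

    defect-positive : ∀ {c x u v} → ¬ Closes c x → Remains c x u v →
                      0ℤ < signℤ G (Sign.opposite x) * (A· (u -ᵐ v)) c
    defect-positive {c} {x} unclosed rem rewrite rem c | δ-self c (signℤ G x) = at-v₀? (c Fin.≟ v₀)
      where
      at-v₀? : (c≟v₀ : Dec (c ≡ v₀)) →
               0ℤ < signℤ G (Sign.opposite x) * (- (if does c≟v₀ then signℤ G d₀ else 0ℤ) - signℤ G x)
      at-v₀? (yes refl) = twice x d₀ (λ x≡-d₀ → unclosed (refl , x≡-d₀))
        where
        twice : ∀ x d → x ≢ Sign.opposite d → 0ℤ < signℤ G (Sign.opposite x) * (- signℤ G d - signℤ G x)
        twice Sign.+ Sign.+ _   = ℤ.+<+ (s≤s z≤n)
        twice Sign.- Sign.- _   = ℤ.+<+ (s≤s z≤n)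
        twice Sign.+ Sign.- x≢d = ⊥-elim (x≢d refl)
        twice Sign.- Sign.+ x≢d = ⊥-elim (x≢d refl)
      at-v₀? (no _) = once x
        where
        once : ∀ x → 0ℤ < signℤ G (Sign.opposite x) * (- 0ℤ - signℤ G x)
        once Sign.+ = ℤ.+<+ (s≤s z≤n)
        once Sign.- = ℤ.+<+ (s≤s z≤n)

    next-edge : ∀ {c x u v} → ¬ Closes c x → Remains c x u v →
      ∃ λ e → ∃ λ s → ∃ λ o → SameEnds (ends e) (c , o) × s Sign.* τ e c ≡ Sign.opposite x × Available s e u v
    next-edge {c} {x} {u} {v} unclosed rem =
      let e , 0<termₑ        = ∑-positive term (subst (0ℤ <_) (*-distribˡ-sum (signℤ G y) (λ e → incidence G c e * (u -ᵐ v) e))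
                                                               (defect-positive {c} {x} {u} {v} unclosed rem))
          incident-ce , 0<ₑ  = incidence-positive y c e ((u -ᵐ v) e) 0<termₑ
          o , c-e-o          = incident⇒SameEnds e c incident-ce
          s , turn , avail   = available-side y (τ e c) (lookup u e) (lookup v e) 0<ₑ
      in e , s , o , c-e-o , turn , avail
      where
      y : Sign
      y = Sign.opposite x
      term : Fin m → ℤ
      term e = signℤ G y * (incidence G c e * (u -ᵐ v) e)

    data Trail : Fin n → Sign → Monomial m → Monomial m → List (Step n m) → Set where
      closed : ∀ {x u v} → x ≡ Sign.opposite d₀ → Trail v₀ x u v []
      extend : ∀ {c x u v L} e s o → SameEnds (ends e) (c , o) → s Sign.* τ e c ≡ Sign.opposite x →
               Available s e u v → Trail o (s Sign.* τ e o) (decrementˡ s e u) (decrementʳ s e v) L →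
               Trail c x u v (step c e s ∷ L)

    greedyTrail : ∀ fuel {c x u v} → size u v ℕ.< fuel → Remains c x u v → ∃ (Trail c x u v)
    greedyTrail (suc fuel) {c} {x} {u} {v} size<fuel rem with (c Fin.≟ v₀) ×-dec (x Sign.≟ Sign.opposite d₀)
    ... | yes (refl , x≡-d₀) = [] , closed x≡-d₀
    ... | no unclosed =
      let e , s , o , c-e-o , turn , avail = next-edge {c} {x} {u} {v} unclosed rem
          size′<fuel = ℕP.≤-trans (ℕP.≤-reflexive (size-decrement s e u v avail)) (ℕP.≤-pred size<fuel)
          L , trail = greedyTrail fuel {o} {s Sign.* τ e o} {decrementˡ s e u} {decrementʳ s e v} size′<fuel
                                  (remains-step {c} {x} {u} {v} e s o c-e-o turn avail rem)
      in step c e s ∷ L , extend e s o c-e-o turn avail trail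

    Consecutive : Step n m → Step n m → Set
    Consecutive st st′ =
      SameEnds (ends (Step.edge st)) (Step.vertex st , Step.vertex st′) ×
      Step.side st′ Sign.* τ (Step.edge st′) (Step.vertex st′)
        ≡ Sign.opposite (Step.side st Sign.* τ (Step.edge st) (Step.vertex st′))

    Closing : Step n m → Set
    Closing st = SameEnds (ends (Step.edge st)) (Step.vertex st , v₀) × Step.side st Sign.* τ (Step.edge st) v₀ ≡ Sign.opposite d₀

    trail-consecutive : ∀ {c x u v st L} → Trail c x u v (st ∷ L) →
                        ∀ i → Consecutive (List.lookup (st ∷ L) (inject₁ i)) (List.lookup (st ∷ L) (suc i))
    trail-consecutive (extend e s o c-e-o turn _ (extend _ _ _ _ turn′ _ _)) zero = c-e-o , turn′
    trail-consecutive (extend _ _ _ _ _ _ trail@(extend _ _ _ _ _ _ _)) (suc i) = trail-consecutive trail i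

    trail-last : ∀ {c x u v st L} → Trail c x u v (st ∷ L) → Closing (List.lookup (st ∷ L) (fromℕ (length L)))
    trail-last (extend e s o c-e-o _ _ (closed arrive))          = c-e-o , arrive
    trail-last (extend _ _ _ _ _ _ trail@(extend _ _ _ _ _ _ _)) = trail-last trail

    trail-first : ∀ {c x u v e s L} → Trail c x u v (step c e s ∷ L) → s Sign.* τ e c ≡ Sign.opposite x
    trail-first (extend _ _ _ _ turn _ _) = turn

    trail-nonempty : ∀ {c x u v L} → c ≢ v₀ → Trail c x u v L → 1 ℕ.≤ length L
    trail-nonempty c≢v₀ (closed _)             = ⊥-elim (c≢v₀ refl)
    trail-nonempty c≢v₀ (extend _ _ _ _ _ _ _) = s≤s z≤n

    uses-bound : ∀ {c x u v L} → Trail c x u v L → ∀ s e → uses s e L ℕ.≤ pick s (lookup u e) (lookup v e)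
    uses-bound (closed _) s e = z≤n
    uses-bound {u = u} {v} (extend e′ s′ _ _ _ avail trail) s e =
      subst (_ ℕ.≤_) (uses-decrement s′ e′ u v avail s e) (ℕP.+-monoʳ-≤ _ (uses-bound trail s e))

    module TrailWalk {u v e₀ L} (trail : Trail v₀ (Sign.opposite d₀) u v (step v₀ e₀ Sign.+ ∷ L))
                     (1≤|L| : 1 ℕ.≤ length L) where

      F : List (Step n m)
      F = step v₀ e₀ Sign.+ ∷ L

      V : Fin (suc (length L)) → Fin n
      V = Step.vertex ∘ List.lookup F
      E : Fin (suc (length L)) → Fin m
      E = Step.edge ∘ List.lookup F
      S : Fin (suc (length L)) → Sign
      S = Step.side ∘ List.lookup F

      last : Fin (suc (length L))
      last = fromℕ (length L)

      wrap-around : Consecutive (List.lookup F last) (List.lookup F zero)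
      wrap-around = proj₁ (trail-last trail) , trans (trail-first trail) (cong Sign.opposite (sym (proj₂ (trail-last trail))))

      joins : ∀ i → SameEnds (ends (E i)) (V i , V (next G i))
      joins i with Top.view i
      ... | Top.‵fromℕ     = subst (λ j → SameEnds (ends (E last)) (V last , V j)) (sym (next-fromℕ G _)) (proj₁ wrap-around)
      ... | Top.‵inject₁ j = subst (λ j′ → SameEnds (ends (E (inject₁ j))) (V (inject₁ j) , V j′)) (sym (next-inject₁ G j))
                                   (proj₁ (trail-consecutive trail j))

      walk : ClosedWalk G
      walk = record { k = length L ; len≥2 = 1≤|L| ; vtx = V ; edg = E ; joins = joins }

      open ClosedWalk walk using (IsEven; countF; evenSection; edgeMonomial)
      open WalkParity walk using (SectionLabelling; labelling⇒IsEven; evenSection≡; countF≡∑)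

      positive : Fin (suc (length L)) → Bool
      positive = isPositive ∘ S

      labelled : SectionLabelling positive
      labelled zero = subst (λ p → positive p xor positive zero ≡ does (τ (E p) v₀ Sign.* τ e₀ v₀ Sign.≟ Sign.+))
                            (sym (prev-zero G _))
                            (side-flip _ _ (S last) Sign.+ (proj₂ wrap-around))
      labelled (suc i) = subst (λ p → positive p xor positive (suc i)
                                        ≡ does (τ (E p) (V (suc i)) Sign.* τ (E (suc i)) (V (suc i)) Sign.≟ Sign.+))
                               (sym (prev-suc G i))
                               (side-flip _ _ (S (inject₁ i)) (S (suc i)) (proj₂ (trail-consecutive trail i)))

      even : IsEven
      even = labelling⇒IsEven {positive} labelled

      evenSection≡positive : ∀ i → evenSection i ≡ positive i
      evenSection≡positive i = trans (evenSection≡ {positive} labelled i) (not-xor-true (positive i))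
        where
        not-xor-true : ∀ b → not (b xor true) ≡ b
        not-xor-true true  = refl
        not-xor-true false = refl

      edgeMonomial-uses : ∀ b e → lookup (edgeMonomial b) e ≡ uses (sideOf b) e F
      edgeMonomial-uses b e = begin
        lookup (edgeMonomial b) e                                           ≡⟨ VecP.lookup∘tabulate _ e ⟩
        countF (λ i → does (E i Fin.≟ e) ∧ does (evenSection i Bool.≟ b))
          ≡⟨ countF≡∑ (λ i → does (E i Fin.≟ e) ∧ does (evenSection i Bool.≟ b)) ⟩
        ℕΣ.sum (λ i → indicator (does (E i Fin.≟ e) ∧ does (evenSection i Bool.≟ b)))
          ≡⟨ ℕΣ.sum-cong-≗ (λ i → cong (λ z → indicator (does (E i Fin.≟ e) ∧ z))
                 (trans (cong (λ z → does (z Bool.≟ b)) (evenSection≡positive i)) (does-isPositive-≟ (S i) b))) ⟩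
        ℕΣ.sum (λ i → indicator (does (E i Fin.≟ e) ∧ does (S i Sign.≟ sideOf b)))
          ≡⟨ ∑-lookup (λ st → indicator (does (Step.edge st Fin.≟ e) ∧ does (Step.side st Sign.≟ sideOf b))) F ⟩
        uses (sideOf b) e F ∎
        where open ≡-Reasoning

  record EvenWalkWithin (u v : Monomial m) (e₀ : Fin m) : Set where
    field
      walk   : ClosedWalk G
      even   : ClosedWalk.IsEven walk
      α≤u    : ClosedWalk.edgeMonomial walk true ≤ᵐ u
      β≤v    : ClosedWalk.edgeMonomial walk false ≤ᵐ v
      uses-e₀ : 1 ℕ.≤ lookup (ClosedWalk.edgeMonomial walk true) e₀

  evenWalk-within : ∀ {u v} → u ≈ᴬ v → ∀ e₀ → 1 ℕ.≤ lookup u e₀ → EvenWalkWithin u v e₀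
  evenWalk-within {u} {v} u≈ᴬv e₀ 1≤uₑ₀ =
    record { walk = walk ; even = even ; α≤u = bound true ; β≤v = bound false ; uses-e₀ = uses-e₀ }
    where
    v₀ o₀ : Fin n
    v₀ = proj₁ (ends e₀)
    o₀ = proj₂ (ends e₀)
    d₀ : Sign
    d₀ = τ e₀ v₀
    start : Remains v₀ d₀ v₀ (Sign.opposite d₀) u v
    start w = trans (u≈ᴬv w) (sym (cancel (w Fin.≟ v₀)))
      where
      cancel : (w≟v₀ : Dec (w ≡ v₀)) →
               - (if does w≟v₀ then signℤ G d₀ else 0ℤ) - (if does w≟v₀ then signℤ G (Sign.opposite d₀) else 0ℤ) ≡ 0ℤ
      cancel (yes _) = trans (cong (λ z → - signℤ G d₀ - z) (signℤ-opposite G d₀)) (ℤP.+-inverseʳ (- signℤ G d₀))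
      cancel (no _)  = refl
    turn₀ : τ e₀ v₀ ≡ Sign.opposite (Sign.opposite d₀)
    turn₀ = sym (SignP.opposite-involutive d₀)
    u₁ v₁ : Monomial m
    u₁ = decrementˡ Sign.+ e₀ u
    v₁ = decrementʳ Sign.+ e₀ v
    rest : ∃ (Trail v₀ d₀ o₀ (τ e₀ o₀) u₁ v₁)
    rest = greedyTrail v₀ d₀ (suc (size u₁ v₁)) {o₀} {τ e₀ o₀} {u₁} {v₁} ℕP.≤-refl
             (remains-step v₀ d₀ {v₀} {Sign.opposite d₀} {u} {v} e₀ Sign.+ o₀ (inj₁ (refl , refl)) turn₀ 1≤uₑ₀ start)
    trail : Trail v₀ d₀ v₀ (Sign.opposite d₀) u v (step v₀ e₀ Sign.+ ∷ proj₁ rest)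
    trail = extend e₀ Sign.+ o₀ (inj₁ (refl , refl)) turn₀ 1≤uₑ₀ (proj₂ rest)
    open TrailWalk v₀ d₀ trail (trail-nonempty v₀ d₀ (loopless e₀ ∘ sym) (proj₂ rest))
    open ClosedWalk walk using (edgeMonomial)
    bound : ∀ b e → lookup (edgeMonomial b) e ℕ.≤ pick (sideOf b) (lookup u e) (lookup v e)
    bound b e = subst (ℕ._≤ _) (sym (edgeMonomial-uses b e)) (uses-bound v₀ d₀ trail (sideOf b) e)
    uses-e₀ : 1 ℕ.≤ lookup (edgeMonomial true) e₀
    uses-e₀ = subst (1 ℕ.≤_) (sym (edgeMonomial-uses true e₀)) (uses-own-step v₀ e₀ Sign.+ (proj₁ rest))

-- The two inclusions

module Inclusions {c ℓ} (K : Field c ℓ) {n m : ℕ} (G : SignedGraph n m) where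
  open Poly K m
  open Polynomials K m
  open Incidence G
  open Toric G
  open GreedyTrail G using (EvenWalkWithin; evenWalk-within)

  evenWalkBinomial∈toric : ∀ {g} → EvenWalkGen G K g → ⟨ ToricGen G K ⟩∋ g
  evenWalkBinomial∈toric (w , even , refl) =
    subst₂ (λ α′ β′ → ⟨ ToricGen G K ⟩∋ binomial α′ β′) (sym (split-posPart α β)) (sym (split-negPart α β))
      (binomial-factor∈ (Vec.zipWith ℕ._⊓_ α β) _ _
        (generator∈ (ToricGen G K) (α -ᵐ β , ⇒InKernel (SignedEdgeVector.evenWalk-≈ᴬ w even) , refl)))
    where
    α β : Monomial m
    α = ClosedWalk.edgeMonomial w true
    β = ClosedWalk.edgeMonomial w false

  splitOffEvenWalk : ∀ {fuel} → (∀ u v → size u v ℕ.< fuel → u ≈ᴬ v → ⟨ EvenWalkGen G K ⟩∋ binomial u v) →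
                     ∀ {u v} → size u v ℕ.≤ fuel → u ≈ᴬ v → ∀ e₀ → 1 ℕ.≤ lookup u e₀ →
                     ⟨ EvenWalkGen G K ⟩∋ binomial u v
  splitOffEvenWalk {fuel} smaller∈ {u} {v} size≤fuel u≈ᴬv e₀ 1≤uₑ₀ =
    subst₂ (λ u′ v′ → ⟨ EvenWalkGen G K ⟩∋ binomial u′ v′) (∸ᵐ-+ᵐ u α α≤u) (∸ᵐ-+ᵐ v β β≤v)
      (binomial-split∈ (u ∸ᵐ α) (v ∸ᵐ β) α β (generator∈ (EvenWalkGen G K) (walk , even , refl))
        (smaller∈ (u ∸ᵐ α) (v ∸ᵐ β) shrinks
          (≈ᴬ-∸ᵐ {u} {v} {α} {β} u≈ᴬv (SignedEdgeVector.evenWalk-≈ᴬ walk even) α≤u β≤v)))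
    where
    open EvenWalkWithin (evenWalk-within {u} {v} u≈ᴬv e₀ 1≤uₑ₀)
    α β : Monomial m
    α = ClosedWalk.edgeMonomial walk true
    β = ClosedWalk.edgeMonomial walk false
    shrinks : size (u ∸ᵐ α) (v ∸ᵐ β) ℕ.< fuel
    shrinks = ℕP.≤-trans (ℕP.m<m+n _ (ℕP.≤-trans uses-e₀ (ℕP.≤-trans (lookup≤degree α e₀) (ℕP.m≤m+n _ _))))
                         (ℕP.≤-trans (ℕP.≤-reflexive (size-∸ᵐ u v α β α≤u β≤v)) size≤fuel)

  kernelBinomial∈evenWalk : ∀ fuel u v → size u v ℕ.< fuel → u ≈ᴬ v → ⟨ EvenWalkGen G K ⟩∋ binomial u v
  kernelBinomial∈evenWalk (suc fuel) u v size<1+fuel u≈ᴬv = by-support (nonzero-entry u) (nonzero-entry v)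
    where
    split-off : ∀ {u v} → size u v ℕ.≤ fuel → u ≈ᴬ v → ∀ e₀ → 1 ℕ.≤ lookup u e₀ → ⟨ EvenWalkGen G K ⟩∋ binomial u v
    split-off = splitOffEvenWalk (kernelBinomial∈evenWalk fuel)
    size≤fuel : size u v ℕ.≤ fuel
    size≤fuel = ℕP.≤-pred size<1+fuel
    by-support : NonzeroEntry u ⊎ (∀ e → lookup u e ≡ 0) → NonzeroEntry v ⊎ (∀ e → lookup v e ≡ 0) →
                 ⟨ EvenWalkGen G K ⟩∋ binomial u v
    by-support (inj₁ (e₀ , 1≤uₑ₀)) _ = split-off size≤fuel u≈ᴬv e₀ 1≤uₑ₀
    by-support (inj₂ _) (inj₁ (e₀ , 1≤vₑ₀)) =
      binomial-swap∈ u v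
        (split-off (subst (ℕ._≤ fuel) (ℕP.+-comm (degree u) (degree v)) size≤fuel) (≈ᴬ-sym {u} {v} u≈ᴬv) e₀ 1≤vₑ₀)
    by-support (inj₂ u≡0) (inj₂ v≡0) =
      subst (λ v′ → ⟨ EvenWalkGen G K ⟩∋ binomial u v′) (lookup-ext λ e → trans (u≡0 e) (sym (v≡0 e)))
            (binomial-self∈ u)

  toricBinomial∈evenWalk : ∀ {g} → ToricGen G K g → ⟨ EvenWalkGen G K ⟩∋ g
  toricBinomial∈evenWalk (b , b∈ker , refl) =
    kernelBinomial∈evenWalk (suc (size (posPart G b) (negPart G b))) _ _ ℕP.≤-refl (InKernel⇒≈ᴬ b∈ker)

proposition2p12 : ∀ {c ℓ} (K : Field c ℓ) {n m : ℕ} (G : SignedGraph n m) →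
    Poly.SameIdeal K m (ToricGen G K) (EvenWalkGen G K)
proposition2p12 K {m = m} G = Polynomials.sameIdeal K m toricBinomial∈evenWalk evenWalkBinomial∈toric
  where open Inclusions K G
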